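{- Every ZLRR has a derived PLRR. That is, for every $s$-deep Zero Linear Recurrence Relation $G_{n+1}=c_1G_n+\cdots+c_LG_{n+1-L}$ there exists a Positive Linear Recurrence Relation $H_{n+1}=b_1H_n+\cdots+b_MH_{n+1-M}$ such that its characteristic polynomial $P_b(x)$ satisfies $P_b(x)=P_a(x)Q(x)$ for some nonzero polynomial $Q(x)$ with integer coefficients, where $P_a(x)$ is the characteristic polynomial of the ZLRR.
   Context: A recurrence relation $a_{n+1}=c_1a_n+\cdots+c_ka_{n+1-k}$ has characteristic polynomial $x^k-c_1x^{k-1}-c_2x^{k-2}-\cdots-c_k$. A Positive Linear Recurrence Relation (PLRR) is a recurrence $H_{n+1}=b_1H_n+\cdots+b_MH_{n+1-M}$ with $M,b_1,\dots,b_M$ non-negative integers and $M$, $b_1$, $b_M$ positive. An $s$-deep Zero Linear Recurrence Relation (ZLRR) is a recurrence $G_{n+1}=c_1G_n+\cdots+c_LG_{n+1-L}$ where $s,L,c_1,\dots,c_L$ are non-negative integers with $c_1=\cdots=c_s=0$, and $L$, $c_{s+1}$, $c_L$ positive, and such that the set $S=\{m : c_m\neq 0\}$ satisfies $\gcd(S)=1$. A recurrence relation $R_b$ is derived from a recurrence relation $R_a$ if $P_b(x)=P_a(x)Q(x)$ where $P_a,P_b$ are their characteristic polynomials and $Q(x)$ is a nonzero polynomial with integer coefficients. -}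

module Defs where

open import Data.Nat using (ℕ; zero; suc; _<_; _≤_; _≟_)
open import Data.Nat.GCD using (gcd)
open import Data.Integer as ℤ using (ℤ; +_; -_)
open import Data.List using (List; []; _∷_; length; reverse; map; _++_; filter; upTo)
open import Data.Product using (Σ; ∃; _×_)
open import Relation.Nullary using (¬_; ¬?)
open import Relation.Binary.PropositionalEquality using (_≡_; _≢_)

-- Recurrence coefficients.
-- A recurrence a_{n+1} = c_1 a_n + ... + c_L a_{n+1-L} is represented by
-- the list  c = c_1 ∷ c_2 ∷ ... ∷ c_L ∷ []  (so L = length c).

-- 1-based access: coef c m = c_m for 1 ≤ m ≤ length c, and 0 otherwise.
coef : List ℕ → ℕ → ℕ
coef []       _             = 0
coef (x ∷ xs) zero          = 0
coef (x ∷ xs) (suc zero)    = x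
coef (x ∷ xs) (suc (suc m)) = coef xs (suc m)

oneTo : ℕ → List ℕ
oneTo n = map suc (upTo n)

support : List ℕ → List ℕ
support c = filter (λ m → ¬? (coef c m ≟ 0)) (oneTo (length c))

gcdList : List ℕ → ℕ
gcdList []       = 0
gcdList (x ∷ xs) = gcd x (gcdList xs)

-- Positive Linear Recurrence Relation: M ≥ 1, b_1 > 0, b_M > 0
-- (non-negativity is built in, coefficients are naturals).
record IsPLRR (b : List ℕ) : Set where
  field
    M-pos   : 0 < length b
    b₁-pos  : 0 < coef b 1
    bM-pos  : 0 < coef b (length b)

record IsZLRR (s : ℕ) (c : List ℕ) : Set where
  field
    L-pos     : 0 < length c
    s<L       : s < length c          -- needed for c_{s+1} to exist
    zeros     : ∀ m → 1 ≤ m → m ≤ s → coef c m ≡ 0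
    cs+1-pos  : 0 < coef c (suc s)
    cL-pos    : 0 < coef c (length c)
    gcd-one   : gcdList (support c) ≡ 1

-- Integer polynomials as coefficient lists in ascending degree order
-- (p = a₀ ∷ a₁ ∷ ... represents a₀ + a₁ x + ...).

Poly : Set
Poly = List ℤ

pcoef : Poly → ℕ → ℤ
pcoef []       _       = + 0
pcoef (a ∷ p)  zero    = a
pcoef (a ∷ p)  (suc k) = pcoef p k

_+ₚ_ : Poly → Poly → Poly
[]      +ₚ q       = q
(a ∷ p) +ₚ []      = a ∷ p
(a ∷ p) +ₚ (b ∷ q) = (a ℤ.+ b) ∷ (p +ₚ q)

scaleₚ : ℤ → Poly → Poly
scaleₚ a = map (a ℤ.*_)

_*ₚ_ : Poly → Poly → Poly
[]      *ₚ q = []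
(a ∷ p) *ₚ q = scaleₚ a q +ₚ (+ 0 ∷ (p *ₚ q))

-- equality of polynomials (coefficientwise; trailing zeros irrelevant)
_≈ₚ_ : Poly → Poly → Set
p ≈ₚ q = ∀ k → pcoef p k ≡ pcoef q k

NonzeroPoly : Poly → Set
NonzeroPoly q = ∃ λ k → pcoef q k ≢ + 0

-- Characteristic polynomial x^L - c_1 x^{L-1} - ... - c_L,
-- i.e. ascending coefficients  -c_L, -c_{L-1}, ..., -c_1, 1.
charPoly : List ℕ → Poly
charPoly c = map (λ x → - (+ x)) (reverse c) ++ (+ 1 ∷ [])

DerivedFrom : List ℕ → List ℕ → Set
DerivedFrom b a = Σ Poly λ Q → NonzeroPoly Q × (charPoly b ≈ₚ (charPoly a *ₚ Q))

-- If s = 0 the recurrence is itself a PLRR.  Otherwise let ρ_n be the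
-- coefficient vector of x^n mod P, where P = charPoly c has degree L.  Then
-- x^{n+1} - x^n - (ρ_{n+1} - ρ_n)(x) is a multiple of P, and for n ≥ L it is the
-- characteristic polynomial of a PLRR as soon as every entry of ρ_{n+1} - ρ_n is
-- positive.  Multiplication by x mod P is a nonnegative linear map, and it is
-- primitive because gcd S = 1 makes every large integer a sum of elements of S:
-- a fixed power of it sends each nonnegative vector to one whose entries all
-- dominate each of its entries.  A Birkhoff-type contraction argument then traps
-- the ratios (ρ_{n+1} - ρ_n)/ρ_{n+1} in intervals whose width shrinks
-- geometrically, while the two nonzero coefficients c_{s+1} and c_L (with s+1 < L)
-- keep the upper end of the intervals above 1/(2L); so the lower end eventually
-- becomes positive.

module Submission where

open import Defs
open import Data.Nat as ℕ using (ℕ; zero; suc; z≤n; s≤s)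
import Data.Nat.Properties as ℕₚ
open import Data.Integer as ℤ using (ℤ; +_; -_; 0ℤ; 1ℤ; -1ℤ; _+_; _*_; _-_; _^_; _≤_; _<_)
import Data.Integer.Properties as ℤₚ
open import Data.Integer.Tactic.RingSolver using (solve-∀)
open import Data.Nat.Tactic.RingSolver using () renaming (solve-∀ to ℕ-solve-∀)
open import Data.Nat.DivMod using (_/_; _%_; m≡m%n+[m/n]*n; m%n<n)
open import Data.Nat.Divisibility using (_∣_; _∣0; ∣m∣n⇒∣m+n; ∣m+n∣m⇒∣n; ∣-reflexive; ∣1⇒≡1)
open import Data.Nat.GCD using (gcd; gcd-GCD; module Bézout)
open import Data.List.Relation.Unary.All as All using (All; []; _∷_)
open import Data.List.Relation.Unary.All.Properties using (all-filter)
open import Data.List using (List; []; _∷_; length; reverse; map; _++_; replicate; applyUpTo)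
open import Data.Nat.ListAction using (sum)
import Data.List.Properties as Listₚ
open import Data.Product using (Σ; ∃; _×_; _,_; proj₁; proj₂)
open import Data.Sum using (_⊎_; inj₁; inj₂)
open import Data.Empty using (⊥-elim)
open import Function using (_∘_)
open import Relation.Binary.PropositionalEquality
open import Relation.Nullary using (¬_; ¬?; yes; no)
open import Relation.Binary.Definitions using (tri<; tri≈; tri>)
open import Algebra.Properties.CommutativeSemigroup ℤₚ.+-commutativeSemigroup using (x∙yz≈y∙xz)

0≤+ : ∀ n → 0ℤ ≤ + n
0≤+ n = ℤ.+≤+ z≤n

0≤*0≤ : ∀ {i j} → 0ℤ ≤ i → 0ℤ ≤ j → 0ℤ ≤ i * j
0≤*0≤ {+ m} {+ n} _ _ = subst (0ℤ ≤_) (ℤₚ.pos-* m n) (0≤+ _)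

0≤+0≤ : ∀ {i j} → 0ℤ ≤ i → 0ℤ ≤ j → 0ℤ ≤ i + j
0≤+0≤ = ℤₚ.+-mono-≤

*-monoˡ-≤-0≤ : ∀ {k i j} → 0ℤ ≤ k → i ≤ j → k * i ≤ k * j
*-monoˡ-≤-0≤ {k} hk = ℤₚ.*-monoˡ-≤-nonNeg k {{ℤ.nonNegative hk}}

*-monoʳ-≤-0≤ : ∀ {k i j} → 0ℤ ≤ k → i ≤ j → i * k ≤ j * k
*-monoʳ-≤-0≤ {k} hk = ℤₚ.*-monoʳ-≤-nonNeg k {{ℤ.nonNegative hk}}

*-mono-≤-0≤ : ∀ {i j k l} → 0ℤ ≤ i → i ≤ j → 0ℤ ≤ k → k ≤ l → i * k ≤ j * l
*-mono-≤-0≤ {i} {j} {k} {l} 0≤i i≤j 0≤k k≤l = ℤₚ.≤-trans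
  (subst₂ _≤_ (ℤₚ.*-comm k i) (ℤₚ.*-comm k j) (*-monoˡ-≤-0≤ 0≤k i≤j))
  (*-monoˡ-≤-0≤ (ℤₚ.≤-trans 0≤i i≤j) k≤l)

1≤*1≤ : ∀ {i j} → 1ℤ ≤ i → 1ℤ ≤ j → 1ℤ ≤ i * j
1≤*1≤ 1≤i 1≤j = *-mono-≤-0≤ (0≤+ 1) 1≤i (0≤+ 1) 1≤j

i≤i+0≤ : ∀ {i j} → 0ℤ ≤ j → i ≤ i + j
i≤i+0≤ {i} {j} 0≤j = subst (_≤ i + j) (ℤₚ.+-identityʳ i) (ℤₚ.+-monoʳ-≤ i 0≤j)

i≤0≤+i : ∀ {i j} → 0ℤ ≤ j → i ≤ j + i
i≤0≤+i {i} {j} 0≤j = subst (_≤ j + i) (ℤₚ.+-identityˡ i) (ℤₚ.+-monoˡ-≤ i 0≤j)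

i<j⇒0<j-i : ∀ {i j} → i < j → 0ℤ < j - i
i<j⇒0<j-i {i} {j} h = subst (_< j - i) (ℤₚ.+-inverseʳ i) (ℤₚ.+-monoˡ-< (- i) h)

0<*⇒0< : ∀ {i j} → 0ℤ < i → 0ℤ < i * j → 0ℤ < j
0<*⇒0< {+ zero}  (ℤ.+<+ ())
0<*⇒0< {+ suc m} {j} _ h =
  ℤₚ.*-cancelˡ-<-nonNeg (+ suc m) (subst (_< + suc m * j) (sym (ℤₚ.*-zeroʳ (+ suc m))) h)

0≤*⇒0≤ : ∀ {i j} → 0ℤ < i → 0ℤ ≤ i * j → 0ℤ ≤ j
0≤*⇒0≤ {+ zero}  (ℤ.+<+ ())
0≤*⇒0≤ {+ suc m} {j} _ h =
  ℤₚ.*-cancelˡ-≤-pos 0ℤ j (+ suc m) (subst (_≤ + suc m * j) (sym (ℤₚ.*-zeroʳ (+ suc m))) h)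

^-0≤ : ∀ {x} n → 0ℤ ≤ x → 0ℤ ≤ x ^ n
^-0≤ zero    _   = 0≤+ 1
^-0≤ (suc n) 0≤x = 0≤*0≤ 0≤x (^-0≤ n 0≤x)

^-1≤ : ∀ {x} n → 1ℤ ≤ x → 1ℤ ≤ x ^ n
^-1≤ zero    _   = ℤₚ.≤-refl
^-1≤ (suc n) 1≤x = 1≤*1≤ 1≤x (^-1≤ n 1≤x)

bernoulli-minus : ∀ x m → 1ℤ ≤ x → x * x ^ m ≤ x * (x - 1ℤ) ^ m + + m * x ^ m
bernoulli-minus x zero    _   = ℤₚ.≤-reflexive (sym (ℤₚ.+-identityʳ (x * 1ℤ)))
bernoulli-minus x (suc m) 1≤x = ℤₚ.0≤i-j⇒j≤i (subst (0ℤ ≤_) (identity x (x ^ m) ((x - 1ℤ) ^ m) (+ m))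
  (0≤+0≤ (0≤*0≤ (ℤₚ.i≤j⇒0≤j-i 1≤x) (ℤₚ.i≤j⇒0≤j-i (bernoulli-minus x m 1≤x)))
         (0≤*0≤ (0≤+ m) (^-0≤ m (ℤₚ.≤-trans (0≤+ 1) 1≤x)))))
  where
  identity : ∀ x a b m → (x - 1ℤ) * (x * b + m * a - x * a) + m * a
                       ≡ x * ((x - 1ℤ) * b) + (1ℤ + m) * (x * a) - x * (x * a)
  identity = solve-∀

bernoulli-plus : ∀ s m → 0ℤ ≤ s → s ^ m * (s + + m) ≤ (s + 1ℤ) ^ m * s
bernoulli-plus s zero    _   = ℤₚ.≤-reflexive (cong (1ℤ *_) (ℤₚ.+-identityʳ s))
bernoulli-plus s (suc m) 0≤s = ℤₚ.0≤i-j⇒j≤i (subst (0ℤ ≤_) (identity s (s ^ m) ((s + 1ℤ) ^ m) (+ m))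
  (0≤+0≤ (0≤*0≤ (0≤+0≤ 0≤s (0≤+ 1)) (ℤₚ.i≤j⇒0≤j-i (bernoulli-plus s m 0≤s)))
         (0≤*0≤ (^-0≤ m 0≤s) (0≤+ m))))
  where
  identity : ∀ s a b m → (s + 1ℤ) * (b * s - a * (s + m)) + a * m
                       ≡ (s + 1ℤ) * b * s - s * a * (s + (1ℤ + m))
  identity = solve-∀

Σ< : (ℕ → ℤ) → ℕ → ℤ
Σ< σ zero    = 0ℤ
Σ< σ (suc n) = Σ< σ n + σ n

Σ<-linear : ∀ a σ b τ n → Σ< (λ j → a * σ j + b * τ j) n ≡ a * Σ< σ n + b * Σ< τ n
Σ<-linear a σ b τ zero    = identity a b
  where
  identity : ∀ a b → 0ℤ ≡ a * 0ℤ + b * 0ℤ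
  identity = solve-∀
Σ<-linear a σ b τ (suc n) = trans (cong (_+ (a * σ n + b * τ n)) (Σ<-linear a σ b τ n))
  (identity a b (Σ< σ n) (Σ< τ n) (σ n) (τ n))
  where
  identity : ∀ a b x y u v → a * x + b * y + (a * u + b * v) ≡ a * (x + u) + b * (y + v)
  identity = solve-∀

Σ<-0≤ : ∀ σ n → (∀ i → i ℕ.< n → 0ℤ ≤ σ i) → 0ℤ ≤ Σ< σ n
Σ<-0≤ σ zero    _  = ℤₚ.≤-refl
Σ<-0≤ σ (suc n) h = 0≤+0≤ (Σ<-0≤ σ n (λ i i<n → h i (ℕₚ.m<n⇒m<1+n i<n))) (h n (ℕₚ.n<1+n n))

Σ<-≤-* : ∀ σ x n → (∀ i → i ℕ.< n → σ i ≤ x) → Σ< σ n ≤ + n * x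
Σ<-≤-* σ x zero    _ = ℤₚ.≤-refl
Σ<-≤-* σ x (suc n) h = ℤₚ.≤-trans
  (ℤₚ.+-mono-≤ (Σ<-≤-* σ x n (λ i i<n → h i (ℕₚ.m<n⇒m<1+n i<n))) (h n (ℕₚ.n<1+n n)))
  (ℤₚ.≤-reflexive (identity (+ n) x))
  where
  identity : ∀ n x → n * x + x ≡ (1ℤ + n) * x
  identity = solve-∀

≤-Σ< : ∀ σ n → (∀ i → i ℕ.< n → 0ℤ ≤ σ i) → ∀ i → i ℕ.< n → σ i ≤ Σ< σ n
≤-Σ< σ (suc n) h i i<1+n with ℕₚ.m<1+n⇒m<n∨m≡n i<1+n
... | inj₁ i<n  = ℤₚ.≤-trans (≤-Σ< σ n h′ i i<n) (i≤i+0≤ (h n (ℕₚ.n<1+n n)))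
  where h′ = λ i i<n → h i (ℕₚ.m<n⇒m<1+n i<n)
... | inj₂ refl = i≤0≤+i (Σ<-0≤ σ n (λ i i<n → h i (ℕₚ.m<n⇒m<1+n i<n)))

replicate-+ : ∀ {A : Set} m n (x : A) → replicate (m ℕ.+ n) x ≡ replicate m x ++ replicate n x
replicate-+ zero    n x = refl
replicate-+ (suc m) n x = cong (x ∷_) (replicate-+ m n x)

applyUpTo-cong : ∀ {A : Set} {f g : ℕ → A} n → (∀ i → i ℕ.< n → f i ≡ g i) → applyUpTo f n ≡ applyUpTo g n
applyUpTo-cong zero    _   = refl
applyUpTo-cong (suc n) f≗g = cong₂ _∷_ (f≗g 0 (s≤s z≤n)) (applyUpTo-cong n (λ i i<n → f≗g (suc i) (s≤s i<n)))

pcoef-+ₚ : ∀ p q k → pcoef (p +ₚ q) k ≡ pcoef p k + pcoef q k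
pcoef-+ₚ []      q       k       = sym (ℤₚ.+-identityˡ _)
pcoef-+ₚ (a ∷ p) []      k       = sym (ℤₚ.+-identityʳ _)
pcoef-+ₚ (a ∷ p) (b ∷ q) zero    = refl
pcoef-+ₚ (a ∷ p) (b ∷ q) (suc k) = pcoef-+ₚ p q k

pcoef-scaleₚ : ∀ a p k → pcoef (scaleₚ a p) k ≡ a * pcoef p k
pcoef-scaleₚ a []      k       = sym (ℤₚ.*-zeroʳ a)
pcoef-scaleₚ a (x ∷ p) zero    = refl
pcoef-scaleₚ a (x ∷ p) (suc k) = pcoef-scaleₚ a p k

pcoef-*ₚ-zero : ∀ p q → (∀ k → pcoef q k ≡ 0ℤ) → ∀ k → pcoef (p *ₚ q) k ≡ 0ℤ
pcoef-*ₚ-zero []      q q≈0 k = refl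
pcoef-*ₚ-zero (a ∷ p) q q≈0 k = begin
  pcoef (scaleₚ a q +ₚ (+ 0 ∷ (p *ₚ q))) k  ≡⟨ pcoef-+ₚ (scaleₚ a q) _ k ⟩
  pcoef (scaleₚ a q) k + pcoef (+ 0 ∷ (p *ₚ q)) k
    ≡⟨ cong₂ _+_ (trans (pcoef-scaleₚ a q k) (trans (cong (a *_) (q≈0 k)) (ℤₚ.*-zeroʳ a))) (shifted k) ⟩
  0ℤ                                        ∎
  where
  open ≡-Reasoning
  shifted : ∀ k → pcoef (+ 0 ∷ (p *ₚ q)) k ≡ 0ℤ
  shifted zero    = refl
  shifted (suc k) = pcoef-*ₚ-zero p q q≈0 k

pcoef-*ₚ-∷ : ∀ p a q k → pcoef (p *ₚ (a ∷ q)) k ≡ a * pcoef p k + pcoef (+ 0 ∷ (p *ₚ q)) k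
pcoef-*ₚ-∷ []      a q zero    = sym (trans (ℤₚ.+-identityʳ _) (ℤₚ.*-zeroʳ a))
pcoef-*ₚ-∷ []      a q (suc k) = sym (trans (ℤₚ.+-identityʳ _) (ℤₚ.*-zeroʳ a))
pcoef-*ₚ-∷ (b ∷ p) a q zero    = cong (_+ 0ℤ) (ℤₚ.*-comm b a)
pcoef-*ₚ-∷ (b ∷ p) a q (suc k) = begin
  pcoef (scaleₚ b q +ₚ (p *ₚ (a ∷ q))) k
    ≡⟨ pcoef-+ₚ (scaleₚ b q) _ k ⟩
  pcoef (scaleₚ b q) k + pcoef (p *ₚ (a ∷ q)) k
    ≡⟨ cong₂ _+_ (pcoef-scaleₚ b q k) (pcoef-*ₚ-∷ p a q k) ⟩
  b * pcoef q k + (a * pcoef p k + pcoef (+ 0 ∷ (p *ₚ q)) k)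
    ≡⟨ x∙yz≈y∙xz (b * pcoef q k) (a * pcoef p k) _ ⟩
  a * pcoef p k + (b * pcoef q k + pcoef (+ 0 ∷ (p *ₚ q)) k)
    ≡⟨ cong (_+_ (a * pcoef p k)) (sym (trans (pcoef-+ₚ (scaleₚ b q) _ k) (cong (_+ pcoef (+ 0 ∷ (p *ₚ q)) k) (pcoef-scaleₚ b q k)))) ⟩
  a * pcoef p k + pcoef (scaleₚ b q +ₚ (+ 0 ∷ (p *ₚ q))) k ∎
  where open ≡-Reasoning

pcoef-++ʳ : ∀ xs ys j → pcoef (xs ++ ys) (length xs ℕ.+ j) ≡ pcoef ys j
pcoef-++ʳ []       ys j = refl
pcoef-++ʳ (x ∷ xs) ys j = pcoef-++ʳ xs ys j

pcoef-++-prefix : ∀ xs ys zs → length xs ≡ length ys →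
                  ∀ j → pcoef (xs ++ zs) j ≡ pcoef (ys ++ zs) j + (pcoef xs j - pcoef ys j)
pcoef-++-prefix []       []       zs _  j       = sym (ℤₚ.+-identityʳ (pcoef zs j))
pcoef-++-prefix (x ∷ xs) (y ∷ ys) zs _  zero    = identity x y
  where
  identity : ∀ x y → x ≡ y + (x - y)
  identity = solve-∀
pcoef-++-prefix (x ∷ xs) (y ∷ ys) zs eq (suc j) = pcoef-++-prefix xs ys zs (ℕₚ.suc-injective eq) j

pcoef-replicate-0 : ∀ n j → pcoef (replicate n 0ℤ) j ≡ 0ℤ
pcoef-replicate-0 zero    j       = refl
pcoef-replicate-0 (suc n) zero    = refl
pcoef-replicate-0 (suc n) (suc j) = pcoef-replicate-0 n j

pcoef-map-neg : ∀ p j → pcoef (map -_ p) j ≡ - pcoef p j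
pcoef-map-neg []      j       = refl
pcoef-map-neg (a ∷ p) zero    = refl
pcoef-map-neg (a ∷ p) (suc j) = pcoef-map-neg p j

pcoef-applyUpTo-< : ∀ (f : ℕ → ℤ) n j → j ℕ.< n → pcoef (applyUpTo f n) j ≡ f j
pcoef-applyUpTo-< f (suc n) zero    _         = refl
pcoef-applyUpTo-< f (suc n) (suc j) (s≤s j<n) = pcoef-applyUpTo-< (λ i → f (suc i)) n j j<n

pcoef-applyUpTo-≥ : ∀ (f : ℕ → ℤ) n j → n ℕ.≤ j → pcoef (applyUpTo f n) j ≡ 0ℤ
pcoef-applyUpTo-≥ f zero    j       _         = refl
pcoef-applyUpTo-≥ f (suc n) (suc j) (s≤s n≤j) = pcoef-applyUpTo-≥ (λ i → f (suc i)) n j n≤j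

coef-∷-∸ : ∀ x xs n j → j ℕ.< n → coef (x ∷ xs) (suc n ℕ.∸ j) ≡ coef xs (n ℕ.∸ j)
coef-∷-∸ x xs (suc n) zero    _         = refl
coef-∷-∸ x xs (suc n) (suc j) (s≤s j<n) = coef-∷-∸ x xs n j j<n

coef-∷-1+n∸n : ∀ x xs n → coef (x ∷ xs) (suc n ℕ.∸ n) ≡ x
coef-∷-1+n∸n x xs zero    = refl
coef-∷-1+n∸n x xs (suc n) = coef-∷-1+n∸n x xs n

coef-pos⇒index : ∀ d m → 0 ℕ.< coef d m → 0 ℕ.< m × m ℕ.≤ length d
coef-pos⇒index (x ∷ xs) (suc zero)    _      = s≤s z≤n , s≤s z≤n
coef-pos⇒index (x ∷ xs) (suc (suc m)) 0<coef = s≤s z≤n , s≤s (proj₂ (coef-pos⇒index xs (suc m) 0<coef))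

neg+ : ℕ → ℤ
neg+ x = - (+ x)

pcoef-++-length : ∀ xs (y : ℤ) ys → pcoef (xs ++ y ∷ ys) (length xs) ≡ y
pcoef-++-length []       y ys = refl
pcoef-++-length (x ∷ xs) y ys = pcoef-++-length xs y ys

pcoef-negReverse : ∀ c ys j → j ℕ.< length c →
                   pcoef (map neg+ (reverse c) ++ ys) j ≡ neg+ (coef c (length c ℕ.∸ j))
pcoef-negReverse (x ∷ xs) ys j j<1+n
  rewrite Listₚ.unfold-reverse x xs
        | Listₚ.map-++ neg+ (reverse xs) (x ∷ [])
        | Listₚ.++-assoc (map neg+ (reverse xs)) (neg+ x ∷ []) ys
  with ℕₚ.m<1+n⇒m<n∨m≡n j<1+n
... | inj₁ j<n  = trans (pcoef-negReverse xs (neg+ x ∷ ys) j j<n)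
                        (cong neg+ (sym (coef-∷-∸ x xs (length xs) j j<n)))
... | inj₂ refl = begin
  pcoef (map neg+ (reverse xs) ++ neg+ x ∷ ys) (length xs)
    ≡⟨ cong (pcoef (map neg+ (reverse xs) ++ neg+ x ∷ ys)) (sym (trans (Listₚ.length-map neg+ (reverse xs)) (Listₚ.length-reverse xs))) ⟩
  pcoef (map neg+ (reverse xs) ++ neg+ x ∷ ys) (length (map neg+ (reverse xs)))
    ≡⟨ pcoef-++-length (map neg+ (reverse xs)) (neg+ x) ys ⟩
  neg+ x
    ≡⟨ cong neg+ (sym (coef-∷-1+n∸n x xs (length xs))) ⟩
  neg+ (coef (x ∷ xs) (suc (length xs) ℕ.∸ length xs)) ∎
  where open ≡-Reasoning

pcoef-charPoly-< : ∀ c j → j ℕ.< length c → pcoef (charPoly c) j ≡ neg+ (coef c (length c ℕ.∸ j))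
pcoef-charPoly-< c = pcoef-negReverse c (+ 1 ∷ [])

pcoef-charPoly-≥ : ∀ c j → pcoef (charPoly c) (length c ℕ.+ j) ≡ pcoef (1ℤ ∷ []) j
pcoef-charPoly-≥ c j = begin
  pcoef (charPoly c) (length c ℕ.+ j)
    ≡⟨ cong (λ n → pcoef (charPoly c) (n ℕ.+ j)) (sym (trans (Listₚ.length-map neg+ (reverse c)) (Listₚ.length-reverse c))) ⟩
  pcoef (charPoly c) (length (map neg+ (reverse c)) ℕ.+ j)
    ≡⟨ pcoef-++ʳ (map neg+ (reverse c)) (1ℤ ∷ []) j ⟩
  pcoef (1ℤ ∷ []) j ∎
  where open ≡-Reasoning

pcoef-charPoly-length : ∀ c → pcoef (charPoly c) (length c) ≡ 1ℤ
pcoef-charPoly-length c = subst (λ n → pcoef (charPoly c) n ≡ 1ℤ) (ℕₚ.+-identityʳ (length c))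
                                (pcoef-charPoly-≥ c 0)

pcoef-*ₚ-1 : ∀ p k → pcoef (p *ₚ (1ℤ ∷ [])) k ≡ pcoef p k
pcoef-*ₚ-1 p k = begin
  pcoef (p *ₚ (1ℤ ∷ [])) k                     ≡⟨ pcoef-*ₚ-∷ p 1ℤ [] k ⟩
  1ℤ * pcoef p k + pcoef (+ 0 ∷ (p *ₚ [])) k   ≡⟨ cong₂ _+_ (ℤₚ.*-identityˡ (pcoef p k)) (shifted k) ⟩
  pcoef p k + 0ℤ                               ≡⟨ ℤₚ.+-identityʳ (pcoef p k) ⟩
  pcoef p k                                    ∎
  where
  open ≡-Reasoning
  shifted : ∀ k → pcoef (+ 0 ∷ (p *ₚ [])) k ≡ 0ℤ
  shifted zero    = refl
  shifted (suc k) = pcoef-*ₚ-zero p [] (λ _ → refl) k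

charPoly-reverse : ∀ bs → charPoly (reverse bs) ≡ map neg+ bs ++ 1ℤ ∷ []
charPoly-reverse bs = cong (λ xs → map neg+ xs ++ 1ℤ ∷ []) (Listₚ.reverse-involutive bs)

coef-++-last : ∀ ys x → coef (ys ++ x ∷ []) (length (ys ++ x ∷ [])) ≡ x
coef-++-last []            x = refl
coef-++-last (y ∷ [])      x = refl
coef-++-last (y ∷ y′ ∷ ys) x = coef-++-last (y′ ∷ ys) x

coef-reverse-length : ∀ x xs → coef (reverse (x ∷ xs)) (length (reverse (x ∷ xs))) ≡ x
coef-reverse-length x xs rewrite Listₚ.unfold-reverse x xs = coef-++-last (reverse xs) x

zero⊎nonzero : ∀ Q → (∀ k → pcoef Q k ≡ 0ℤ) ⊎ NonzeroPoly Q
zero⊎nonzero []      = inj₁ (λ _ → refl)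
zero⊎nonzero (a ∷ Q) with a ℤₚ.≟ 0ℤ | zero⊎nonzero Q
... | no a≢0   | _                = inj₂ (0 , a≢0)
... | yes refl | inj₁ Q≈0         = inj₁ λ { zero → refl ; (suc k) → Q≈0 k }
... | yes refl | inj₂ (k , Qk≢0)  = inj₂ (suc k , Qk≢0)

derivedFrom : ∀ b a Q → charPoly b ≈ₚ (charPoly a *ₚ Q) → DerivedFrom b a
derivedFrom b a Q Pb≈PaQ = Q , Q≢0 , Pb≈PaQ
  where
  Q≢0 : NonzeroPoly Q
  Q≢0 with zero⊎nonzero Q
  ... | inj₂ Q≢0 = Q≢0
  ... | inj₁ Q≈0 = ⊥-elim (1≢0 (begin
    1ℤ                                ≡⟨ sym (pcoef-charPoly-length b) ⟩
    pcoef (charPoly b) (length b)     ≡⟨ Pb≈PaQ (length b) ⟩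
    pcoef (charPoly a *ₚ Q) (length b) ≡⟨ pcoef-*ₚ-zero (charPoly a) Q Q≈0 (length b) ⟩
    0ℤ                                ∎))
    where
    open ≡-Reasoning
    1≢0 : 1ℤ ≢ 0ℤ
    1≢0 ()

module Sums (Part : ℕ → Set) where

  data Sum : ℕ → Set where
    []  : Sum 0
    _∷_ : ∀ {m n} → Part m → Sum n → Sum (m ℕ.+ n)

  Sum-part : ∀ {m} → Part m → Sum m
  Sum-part {m} p = subst Sum (ℕₚ.+-identityʳ m) (p ∷ [])

  Sum-+ : ∀ {a b} → Sum a → Sum b → Sum (a ℕ.+ b)
  Sum-+ []                  sb = sb
  Sum-+ {b = b} (_∷_ {m} {n} p sa) sb = subst Sum (sym (ℕₚ.+-assoc m n b)) (p ∷ Sum-+ sa sb)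

  Sum-* : ∀ {a} → Sum a → ∀ k → Sum (k ℕ.* a)
  Sum-* sa zero    = []
  Sum-* sa (suc k) = Sum-+ sa (Sum-* sa k)

  Sum-∣ : ∀ {d} → (∀ {m} → Part m → d ∣ m) → ∀ {n} → Sum n → d ∣ n
  Sum-∣ d∣part []       = _ ∣0
  Sum-∣ d∣part (p ∷ sn) = ∣m∣n⇒∣m+n (d∣part p) (Sum-∣ d∣part sn)

  Sum-bézout : ∀ ms → All Part ms → ∃ λ A → ∃ λ B → Sum A × Sum B × A ≡ B ℕ.+ gcdList ms
  Sum-bézout []       []       = 0 , 0 , [] , [] , refl
  Sum-bézout (x ∷ xs) (px ∷ pxs) with Sum-bézout xs pxs | Bézout.identity (gcd-GCD x (gcdList xs))
  ... | A , B , sA , sB , A≡B+g | Bézout.+- u v ux≡g+vg =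
    v ℕ.* B ℕ.+ u ℕ.* x , v ℕ.* A , Sum-+ (Sum-* sB v) (Sum-* (Sum-part px) u) , Sum-* sA v , (begin
      v ℕ.* B ℕ.+ u ℕ.* x                       ≡⟨ cong (v ℕ.* B ℕ.+_) (sym ux≡g+vg) ⟩
      v ℕ.* B ℕ.+ (g ℕ.+ v ℕ.* gcdList xs)       ≡⟨ identity v B g (gcdList xs) ⟩
      v ℕ.* (B ℕ.+ gcdList xs) ℕ.+ g            ≡⟨ cong (λ w → v ℕ.* w ℕ.+ g) (sym A≡B+g) ⟩
      v ℕ.* A ℕ.+ g                             ∎)
    where
    open ≡-Reasoning
    g = gcd x (gcdList xs)
    identity : ∀ v B g g′ → v ℕ.* B ℕ.+ (g ℕ.+ v ℕ.* g′) ≡ v ℕ.* (B ℕ.+ g′) ℕ.+ g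
    identity = ℕ-solve-∀
  ... | A , B , sA , sB , A≡B+g | Bézout.-+ u v vg≡g+ux =
    v ℕ.* A , u ℕ.* x ℕ.+ v ℕ.* B , Sum-* sA v , Sum-+ (Sum-* (Sum-part px) u) (Sum-* sB v) , (begin
      v ℕ.* A                                  ≡⟨ cong (v ℕ.*_) A≡B+g ⟩
      v ℕ.* (B ℕ.+ gcdList xs)                 ≡⟨ ℕₚ.*-distribˡ-+ v B (gcdList xs) ⟩
      v ℕ.* B ℕ.+ v ℕ.* gcdList xs             ≡⟨ cong (v ℕ.* B ℕ.+_) (sym vg≡g+ux) ⟩
      v ℕ.* B ℕ.+ (g ℕ.+ u ℕ.* x)              ≡⟨ identity (v ℕ.* B) g (u ℕ.* x) ⟩
      u ℕ.* x ℕ.+ v ℕ.* B ℕ.+ g                ∎)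
    where
    open ≡-Reasoning
    g = gcd x (gcdList xs)
    identity : ∀ a b d → a ℕ.+ (b ℕ.+ d) ≡ d ℕ.+ a ℕ.+ b
    identity = ℕ-solve-∀

  -- Every n ≥ B² is r A + (q - r) B, where n = q B + r with r < B ≤ q.
  Sum-≥B² : ∀ {A B} → Sum A → Sum B → A ≡ B ℕ.+ 1 → ∀ n → B ℕ.* B ℕ.≤ n → Sum n
  Sum-≥B² {A} {zero}      sA sB A≡1 n _ = subst Sum (ℕₚ.*-identityʳ n) (Sum-* (subst Sum A≡1 sA) n)
  Sum-≥B² {A} {B@(suc _)} sA sB A≡B+1 n B²≤n =
    subst Sum n≡rA+[q∸r]B (Sum-+ (Sum-* sA r) (Sum-* sB (q ℕ.∸ r)))
    where
    r = n % B
    q = n / B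
    n≡r+qB : n ≡ r ℕ.+ q ℕ.* B
    n≡r+qB = m≡m%n+[m/n]*n n B
    B≤q : B ℕ.≤ q
    B≤q = ℕₚ.≮⇒≥ λ q<B → ℕₚ.<⇒≱ (subst (ℕ._< B ℕ.* B) (sym n≡r+qB)
            (ℕₚ.+-mono-<-≤ (m%n<n n B) (ℕₚ.*-monoˡ-≤ B (ℕₚ.≤-pred q<B)))) B²≤n
    n≡rA+[q∸r]B : r ℕ.* A ℕ.+ (q ℕ.∸ r) ℕ.* B ≡ n
    n≡rA+[q∸r]B = begin
      r ℕ.* A ℕ.+ (q ℕ.∸ r) ℕ.* B               ≡⟨ cong (λ a → r ℕ.* a ℕ.+ (q ℕ.∸ r) ℕ.* B) A≡B+1 ⟩
      r ℕ.* (B ℕ.+ 1) ℕ.+ (q ℕ.∸ r) ℕ.* B       ≡⟨ identity r (q ℕ.∸ r) B ⟩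
      r ℕ.+ (r ℕ.+ (q ℕ.∸ r)) ℕ.* B             ≡⟨ cong (λ w → r ℕ.+ w ℕ.* B) (ℕₚ.m+[n∸m]≡n (ℕₚ.≤-trans (ℕₚ.<⇒≤ (m%n<n n B)) B≤q)) ⟩
      r ℕ.+ q ℕ.* B                              ≡⟨ sym n≡r+qB ⟩
      n                                          ∎
      where
      open ≡-Reasoning
      identity : ∀ r d B → r ℕ.* (B ℕ.+ 1) ℕ.+ d ℕ.* B ≡ r ℕ.+ (r ℕ.+ d) ℕ.* B
      identity = ℕ-solve-∀

-- A state σ stands for the polynomial σ₀ + σ₁ x + ⋯ + σ_{L-1} x^{L-1} (entries
-- σ j with j ≥ L are junk), and step σ is x · σ reduced modulo charPoly c using
-- x^L ≡ Σ c_m x^{L-m}; so ρ n is x^n mod charPoly c, and top n its leading entry.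
module Companion (c : List ℕ) where

  L : ℕ
  L = length c

  feedback : ℕ → ℤ
  feedback j = + coef c (L ℕ.∸ j)

  State : Set
  State = ℕ → ℤ

  shift : State → State
  shift σ zero    = 0ℤ
  shift σ (suc j) = σ j

  step : State → State
  step σ j = shift σ j + σ (L ℕ.∸ 1) * feedback j

  stepⁿ : ℕ → State → State
  stepⁿ zero    σ = σ
  stepⁿ (suc n) σ = step (stepⁿ n σ)

  lincomb : ℤ → State → ℤ → State → State
  lincomb a σ b τ j = a * σ j + b * τ j

  step-cong : ∀ {σ τ} → σ ≗ τ → step σ ≗ step τ
  step-cong σ≗τ zero    = cong (λ x → 0ℤ + x * feedback 0) (σ≗τ (L ℕ.∸ 1))
  step-cong σ≗τ (suc j) = cong₂ (λ x y → x + y * feedback (suc j)) (σ≗τ j) (σ≗τ (L ℕ.∸ 1))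

  stepⁿ-cong : ∀ n {σ τ} → σ ≗ τ → stepⁿ n σ ≗ stepⁿ n τ
  stepⁿ-cong zero    σ≗τ = σ≗τ
  stepⁿ-cong (suc n) σ≗τ = step-cong (stepⁿ-cong n σ≗τ)

  stepⁿ-+ : ∀ m n σ → stepⁿ (m ℕ.+ n) σ ≗ stepⁿ m (stepⁿ n σ)
  stepⁿ-+ zero    n σ j = refl
  stepⁿ-+ (suc m) n σ j = step-cong (stepⁿ-+ m n σ) j

  step-lincomb : ∀ a σ b τ → step (lincomb a σ b τ) ≗ lincomb a (step σ) b (step τ)
  step-lincomb a σ b τ zero    = identity a b (σ (L ℕ.∸ 1)) (τ (L ℕ.∸ 1)) (feedback 0)
    where
    identity : ∀ a b x y w → 0ℤ + (a * x + b * y) * w ≡ a * (0ℤ + x * w) + b * (0ℤ + y * w)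
    identity = solve-∀
  step-lincomb a σ b τ (suc j) = identity a b (σ j) (τ j) (σ (L ℕ.∸ 1)) (τ (L ℕ.∸ 1)) (feedback (suc j))
    where
    identity : ∀ a b u v x y w → (a * u + b * v) + (a * x + b * y) * w ≡ a * (u + x * w) + b * (v + y * w)
    identity = solve-∀

  stepⁿ-lincomb : ∀ n a σ b τ → stepⁿ n (lincomb a σ b τ) ≗ lincomb a (stepⁿ n σ) b (stepⁿ n τ)
  stepⁿ-lincomb zero    a σ b τ j = refl
  stepⁿ-lincomb (suc n) a σ b τ j =
    trans (step-cong (stepⁿ-lincomb n a σ b τ) j) (step-lincomb a (stepⁿ n σ) b (stepⁿ n τ) j)

  NonNeg : State → Set
  NonNeg σ = ∀ j → j ℕ.< L → 0ℤ ≤ σ j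

  mass : State → ℤ
  mass σ = Σ< σ L

  L∸1<L : ∀ {j} → j ℕ.< L → L ℕ.∸ 1 ℕ.< L
  L∸1<L {j} j<L = ℕₚ.∸-monoʳ-< {o = 0} (s≤s z≤n) (ℕₚ.<-≤-trans (s≤s z≤n) j<L)

  step-0≤ : ∀ σ j → 0ℤ ≤ shift σ j → 0ℤ ≤ σ (L ℕ.∸ 1) → 0ℤ ≤ step σ j
  step-0≤ σ j 0≤shift 0≤last = 0≤+0≤ 0≤shift (0≤*0≤ 0≤last (0≤+ _))

  step-nonNeg : ∀ {σ} → NonNeg σ → NonNeg (step σ)
  step-nonNeg {σ} σ≥0 zero    j<L = step-0≤ σ 0 ℤₚ.≤-refl (σ≥0 _ (L∸1<L j<L))
  step-nonNeg {σ} σ≥0 (suc j) j<L = step-0≤ σ (suc j) (σ≥0 j (ℕₚ.<-trans (ℕₚ.n<1+n j) j<L)) (σ≥0 _ (L∸1<L j<L))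

  stepⁿ-nonNeg : ∀ n {σ} → NonNeg σ → NonNeg (stepⁿ n σ)
  stepⁿ-nonNeg zero    σ≥0 = σ≥0
  stepⁿ-nonNeg (suc n) σ≥0 = step-nonNeg (stepⁿ-nonNeg n σ≥0)

  G : ℤ
  G = 1ℤ + + sum c

  feedback≤ : ∀ j → feedback j ≤ + sum c
  feedback≤ j = ℤ.+≤+ (coef≤sum c (L ℕ.∸ j))
    where
    coef≤sum : ∀ d m → coef d m ℕ.≤ sum d
    coef≤sum []       m             = z≤n
    coef≤sum (x ∷ xs) zero          = z≤n
    coef≤sum (x ∷ xs) (suc zero)    = ℕₚ.m≤m+n x (sum xs)
    coef≤sum (x ∷ xs) (suc (suc m)) = ℕₚ.≤-trans (coef≤sum xs (suc m)) (ℕₚ.m≤n+m (sum xs) x)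

  BoundedBy : ℤ → State → Set
  BoundedBy B σ = ∀ j → j ℕ.< L → σ j ≤ B

  step-bounded : ∀ {B σ} → NonNeg σ → BoundedBy B σ → BoundedBy (B * G) (step σ)
  step-bounded {B} {σ} σ≥0 σ≤B j j<L = ℤₚ.≤-trans
    (ℤₚ.+-mono-≤ (shift≤ j j<L) (*-mono-≤-0≤ (σ≥0 _ L-1<L) (σ≤B _ L-1<L) (0≤+ _) (feedback≤ j)))
    (ℤₚ.≤-reflexive (identity B (+ sum c)))
    where
    L-1<L = L∸1<L j<L
    shift≤ : ∀ j → j ℕ.< L → shift σ j ≤ B
    shift≤ zero    _   = ℤₚ.≤-trans (σ≥0 _ L-1<L) (σ≤B _ L-1<L)
    shift≤ (suc j) j<L = σ≤B j (ℕₚ.<-trans (ℕₚ.n<1+n j) j<L)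
    identity : ∀ B C → B + B * C ≡ B * (1ℤ + C)
    identity = solve-∀

  stepⁿ-bounded : ∀ n {B σ} → NonNeg σ → BoundedBy B σ → BoundedBy (B * G ^ n) (stepⁿ n σ)
  stepⁿ-bounded zero    {B} σ≥0 σ≤B j j<L = subst (_ ≤_) (sym (ℤₚ.*-identityʳ B)) (σ≤B j j<L)
  stepⁿ-bounded (suc n) {B} σ≥0 σ≤B j j<L = subst (_ ≤_) (identity B G (G ^ n))
    (step-bounded (stepⁿ-nonNeg n σ≥0) (stepⁿ-bounded n σ≥0 σ≤B) j j<L)
    where
    identity : ∀ B g p → B * p * g ≡ B * (g * p)
    identity = solve-∀

  e : ℕ → State
  e zero    zero    = 1ℤ
  e zero    (suc j) = 0ℤ
  e (suc i) zero    = 0ℤ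
  e (suc i) (suc j) = e i j

  e-0≤ : ∀ i j → 0ℤ ≤ e i j
  e-0≤ zero    zero    = 0≤+ 1
  e-0≤ zero    (suc j) = 0≤+ 0
  e-0≤ (suc i) zero    = 0≤+ 0
  e-0≤ (suc i) (suc j) = e-0≤ i j

  e-≢ : ∀ i j → i ≢ j → e i j ≡ 0ℤ
  e-≢ zero    zero    i≢j = ⊥-elim (i≢j refl)
  e-≢ zero    (suc j) _   = refl
  e-≢ (suc i) zero    _   = refl
  e-≢ (suc i) (suc j) i≢j = e-≢ i j (i≢j ∘ cong suc)

  e-diagonal : ∀ i → e i i ≡ 1ℤ
  e-diagonal zero    = refl
  e-diagonal (suc i) = e-diagonal i

  shift-e : ∀ i → shift (e i) ≗ e (suc i)
  shift-e i zero    = refl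
  shift-e i (suc j) = refl

  ρ : ℕ → State
  ρ n = stepⁿ n (e 0)

  top : ℕ → ℤ
  top n = ρ n (L ℕ.∸ 1)

  ρ-0≤ : ∀ n j → 0ℤ ≤ ρ n j
  ρ-0≤ zero    j       = e-0≤ 0 j
  ρ-0≤ (suc n) zero    = step-0≤ (ρ n) 0 ℤₚ.≤-refl (ρ-0≤ n _)
  ρ-0≤ (suc n) (suc j) = step-0≤ (ρ n) (suc j) (ρ-0≤ n j) (ρ-0≤ n _)

  ρ-nonNeg : ∀ n → NonNeg (ρ n)
  ρ-nonNeg n j _ = ρ-0≤ n j

  ρ≗e : ∀ i → i ℕ.< L → ρ i ≗ e i
  ρ≗e zero    _     j = refl
  ρ≗e (suc i) 1+i<L j = begin
    step (ρ i) j                           ≡⟨ step-cong (ρ≗e i (ℕₚ.<-trans (ℕₚ.n<1+n i) 1+i<L)) j ⟩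
    shift (e i) j + e i (L ℕ.∸ 1) * feedback j ≡⟨ cong₂ (λ x y → x + y * feedback j) (shift-e i j) (e-≢ i _ i≢L-1) ⟩
    e (suc i) j + 0ℤ                       ≡⟨ ℤₚ.+-identityʳ _ ⟩
    e (suc i) j                            ∎
    where
    open ≡-Reasoning
    i≢L-1 : i ≢ L ℕ.∸ 1
    i≢L-1 i≡L-1 = ℕₚ.<⇒≱ (subst (λ k → suc k ℕ.< L) i≡L-1 1+i<L) (ℕₚ.m≤n+m∸n L 1)

  ρ≤ρ-shift : ∀ n j → ρ n j ≤ ρ (suc n) (suc j)
  ρ≤ρ-shift n j = i≤i+0≤ (0≤*0≤ (ρ-0≤ n _) (0≤+ _))

  ρ≤ρ-shiftⁱ : ∀ i n j → ρ n j ≤ ρ (i ℕ.+ n) (i ℕ.+ j)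
  ρ≤ρ-shiftⁱ zero    n j = ℤₚ.≤-refl
  ρ≤ρ-shiftⁱ (suc i) n j = ℤₚ.≤-trans (ρ≤ρ-shiftⁱ i n j) (ρ≤ρ-shift (i ℕ.+ n) (i ℕ.+ j))

  top*feedback≤ρ : ∀ n j → top n * feedback j ≤ ρ (suc n) j
  top*feedback≤ρ n zero    = i≤0≤+i ℤₚ.≤-refl
  top*feedback≤ρ n (suc j) = i≤0≤+i (ρ-0≤ n j)

  top*coef≤top : ∀ n q → suc q ℕ.≤ L → top n * + coef c (suc q) ≤ top (n ℕ.+ suc q)
  top*coef≤top n q 1+q≤L = begin
    top n * + coef c (suc q)         ≡⟨ cong (λ m → top n * + coef c m) (sym L∸r≡1+q) ⟩
    top n * feedback r               ≤⟨ top*feedback≤ρ n r ⟩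
    ρ (suc n) r                      ≤⟨ ρ≤ρ-shiftⁱ q (suc n) r ⟩
    ρ (q ℕ.+ suc n) (q ℕ.+ r)        ≡⟨ cong₂ ρ (trans (ℕₚ.+-comm q (suc n)) (sym (ℕₚ.+-suc n q))) q+r≡L-1 ⟩
    top (n ℕ.+ suc q)                ∎
    where
    open ℤₚ.≤-Reasoning
    r = L ℕ.∸ suc q
    L∸r≡1+q : L ℕ.∸ r ≡ suc q
    L∸r≡1+q = ℕₚ.m∸[m∸n]≡n 1+q≤L
    q+r≡L-1 : q ℕ.+ r ≡ L ℕ.∸ 1
    q+r≡L-1 = cong (ℕ._∸ 1) (ℕₚ.m+[n∸m]≡n 1+q≤L)

  top-two-terms≤top : ∀ n q r → L ≡ suc q ℕ.+ suc r →
    top (n ℕ.+ suc r) * + coef c (suc q) + top n * + coef c L ≤ top (n ℕ.+ L)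
  top-two-terms≤top n q r L≡ = begin
    top m * + coef c (suc q) + top n * feedback 0    ≡⟨ ℤₚ.+-comm (top m * + coef c (suc q)) _ ⟩
    top n * feedback 0 + top m * + coef c (suc q)    ≡⟨ cong (λ k → top n * feedback 0 + top m * + coef c k) (sym L∸[1+r]≡1+q) ⟩
    top n * feedback 0 + top m * feedback (suc r)    ≤⟨ ℤₚ.+-monoˡ-≤ _ top*feedback≤ρₘ ⟩
    ρ (suc m) (suc r)                                ≤⟨ ρ≤ρ-shiftⁱ q (suc m) (suc r) ⟩
    ρ (q ℕ.+ suc m) (q ℕ.+ suc r)                    ≡⟨ cong₂ ρ (trans (identity q n r) (cong (n ℕ.+_) (sym L≡))) (cong (ℕ._∸ 1) (sym L≡)) ⟩
    top (n ℕ.+ L)                                    ∎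
    where
    open ℤₚ.≤-Reasoning
    m = n ℕ.+ suc r
    L∸[1+r]≡1+q : L ℕ.∸ suc r ≡ suc q
    L∸[1+r]≡1+q = trans (cong (ℕ._∸ suc r) L≡) (ℕₚ.m+n∸n≡m (suc q) (suc r))
    identity : ∀ q n r → q ℕ.+ suc (n ℕ.+ suc r) ≡ n ℕ.+ (suc q ℕ.+ suc r)
    identity = ℕ-solve-∀
    top*feedback≤ρₘ : top n * feedback 0 ≤ ρ m r
    top*feedback≤ρₘ = ℤₚ.≤-trans (top*feedback≤ρ n 0)
      (subst₂ (λ k j → ρ (suc n) 0 ≤ ρ k j) (trans (ℕₚ.+-comm r (suc n)) (sym (ℕₚ.+-suc n r)))
              (ℕₚ.+-identityʳ r) (ρ≤ρ-shiftⁱ r (suc n) 0))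

  ρ-comb : ℤ → ℤ → ℕ → State
  ρ-comb a b n = lincomb a (ρ (suc n)) b (ρ n)

  stepⁿ-ρ-comb : ∀ m a b n → stepⁿ m (ρ-comb a b n) ≗ ρ-comb a b (m ℕ.+ n)
  stepⁿ-ρ-comb m a b n j = trans (stepⁿ-lincomb m a (ρ (suc n)) b (ρ n) j)
    (cong₂ (λ x y → a * x + b * y)
      (trans (sym (stepⁿ-+ m (suc n) (e 0) j)) (cong (λ k → ρ k j) (ℕₚ.+-suc m n)))
      (sym (stepⁿ-+ m n (e 0) j)))

  increment : ℕ → State
  increment n = ρ-comb 1ℤ -1ℤ n

  ρ-comb-nonNeg : ∀ m a b n → NonNeg (ρ-comb a b n) → NonNeg (ρ-comb a b (m ℕ.+ n))
  ρ-comb-nonNeg m a b n ≥0 j j<L = subst (0ℤ ≤_) (stepⁿ-ρ-comb m a b n j) (stepⁿ-nonNeg m ≥0 j j<L)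

module Remainder (c : List ℕ) where

  open Companion c

  toPoly : State → Poly
  toPoly σ = applyUpTo σ L

  x*toPoly : 0 ℕ.< L → ∀ σ j →
    pcoef (+ 0 ∷ toPoly σ) j ≡ σ (L ℕ.∸ 1) * pcoef (charPoly c) j + pcoef (toPoly (step σ)) j
  x*toPoly 0<L σ zero = sym (begin
    t * pcoef (charPoly c) 0 + pcoef (toPoly (step σ)) 0 ≡⟨ cong₂ (λ x y → t * x + y) (pcoef-charPoly-< c 0 0<L) (pcoef-applyUpTo-< (step σ) L 0 0<L) ⟩
    t * neg+ (coef c L) + (0ℤ + t * feedback 0)          ≡⟨ identity t (+ coef c L) ⟩
    0ℤ                                                     ∎)
    where
    open ≡-Reasoning
    t : ℤ
    t = σ (L ℕ.∸ 1)
    identity : ∀ t x → t * (- x) + (0ℤ + t * x) ≡ 0ℤ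
    identity = solve-∀
  x*toPoly 0<L σ (suc j) with ℕₚ.<-cmp (suc j) L
  ... | tri< 1+j<L _ _ = begin
    pcoef (toPoly σ) j                                      ≡⟨ pcoef-applyUpTo-< σ L j (ℕₚ.<-trans (ℕₚ.n<1+n j) 1+j<L) ⟩
    σ j                                                     ≡⟨ identity t (+ coef c (L ℕ.∸ suc j)) (σ j) ⟩
    t * neg+ (coef c (L ℕ.∸ suc j)) + (σ j + t * feedback (suc j))
      ≡⟨ sym (cong₂ (λ x y → t * x + y) (pcoef-charPoly-< c (suc j) 1+j<L) (pcoef-applyUpTo-< (step σ) L (suc j) 1+j<L)) ⟩
    t * pcoef (charPoly c) (suc j) + pcoef (toPoly (step σ)) (suc j) ∎
    where
    open ≡-Reasoning
    t : ℤ
    t = σ (L ℕ.∸ 1)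
    identity : ∀ t x s → s ≡ t * (- x) + (s + t * x)
    identity = solve-∀
  ... | tri≈ _ 1+j≡L _ = begin
    pcoef (toPoly σ) j                                      ≡⟨ pcoef-applyUpTo-< σ L j (subst (j ℕ.<_) 1+j≡L (ℕₚ.n<1+n j)) ⟩
    σ j                                                     ≡⟨ cong σ (cong (ℕ._∸ 1) 1+j≡L) ⟩
    t                                                       ≡⟨ identity t ⟩
    t * 1ℤ + 0ℤ
      ≡⟨ sym (cong₂ (λ x y → t * x + y) (trans (cong (pcoef (charPoly c)) (trans 1+j≡L (sym (ℕₚ.+-identityʳ L)))) (pcoef-charPoly-≥ c 0))
                                         (pcoef-applyUpTo-≥ (step σ) L (suc j) (ℕₚ.≤-reflexive (sym 1+j≡L)))) ⟩
    t * pcoef (charPoly c) (suc j) + pcoef (toPoly (step σ)) (suc j) ∎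
    where
    open ≡-Reasoning
    t : ℤ
    t = σ (L ℕ.∸ 1)
    identity : ∀ t → t ≡ t * 1ℤ + 0ℤ
    identity = solve-∀
  ... | tri> _ _ L<1+j = begin
    pcoef (toPoly σ) j                                      ≡⟨ pcoef-applyUpTo-≥ σ L j (ℕₚ.≤-pred L<1+j) ⟩
    0ℤ                                                      ≡⟨ identity t ⟩
    t * 0ℤ + 0ℤ
      ≡⟨ sym (cong₂ (λ x y → t * x + y) (trans (cong (pcoef (charPoly c)) 1+j≡L+k) (pcoef-charPoly-≥ c (suc (j ℕ.∸ L))))
                                         (pcoef-applyUpTo-≥ (step σ) L (suc j) (ℕₚ.<⇒≤ L<1+j))) ⟩
    t * pcoef (charPoly c) (suc j) + pcoef (toPoly (step σ)) (suc j) ∎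
    where
    open ≡-Reasoning
    t : ℤ
    t = σ (L ℕ.∸ 1)
    1+j≡L+k : suc j ≡ L ℕ.+ suc (j ℕ.∸ L)
    1+j≡L+k = sym (trans (ℕₚ.+-suc L (j ℕ.∸ L)) (cong suc (ℕₚ.m+[n∸m]≡n (ℕₚ.≤-pred L<1+j))))
    identity : ∀ t → 0ℤ ≡ t * 0ℤ + 0ℤ
    identity = solve-∀

  pcoef-0∷-+ₚ : ∀ V A B → V ≈ₚ (A +ₚ B) → ∀ j → pcoef (+ 0 ∷ V) j ≡ pcoef (+ 0 ∷ A) j + pcoef (+ 0 ∷ B) j
  pcoef-0∷-+ₚ V A B V≈A+B zero    = refl
  pcoef-0∷-+ₚ V A B V≈A+B (suc j) = trans (V≈A+B j) (pcoef-+ₚ A B j)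

  step-remainder : 0 ℕ.< L → ∀ V Q σ → V ≈ₚ ((charPoly c *ₚ Q) +ₚ toPoly σ) →
                   (+ 0 ∷ V) ≈ₚ ((charPoly c *ₚ (σ (L ℕ.∸ 1) ∷ Q)) +ₚ toPoly (step σ))
  step-remainder 0<L V Q σ V≈PQ+σ j = begin
    pcoef (+ 0 ∷ V) j                                          ≡⟨ pcoef-0∷-+ₚ V (P *ₚ Q) (toPoly σ) V≈PQ+σ j ⟩
    pcoef (+ 0 ∷ (P *ₚ Q)) j + pcoef (+ 0 ∷ toPoly σ) j        ≡⟨ cong (_+_ (pcoef (+ 0 ∷ (P *ₚ Q)) j)) (x*toPoly 0<L σ j) ⟩
    pcoef (+ 0 ∷ (P *ₚ Q)) j + (t * pcoef P j + pcoef (toPoly (step σ)) j)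
      ≡⟨ identity (pcoef (+ 0 ∷ (P *ₚ Q)) j) (t * pcoef P j) (pcoef (toPoly (step σ)) j) ⟩
    t * pcoef P j + pcoef (+ 0 ∷ (P *ₚ Q)) j + pcoef (toPoly (step σ)) j
      ≡⟨ cong (_+ pcoef (toPoly (step σ)) j) (sym (pcoef-*ₚ-∷ P t Q j)) ⟩
    pcoef (P *ₚ (t ∷ Q)) j + pcoef (toPoly (step σ)) j         ≡⟨ sym (pcoef-+ₚ (P *ₚ (t ∷ Q)) (toPoly (step σ)) j) ⟩
    pcoef ((P *ₚ (t ∷ Q)) +ₚ toPoly (step σ)) j                ∎
    where
    open ≡-Reasoning
    P : Poly
    P = charPoly c
    t : ℤ
    t = σ (L ℕ.∸ 1)
    identity : ∀ a b d → a + (b + d) ≡ b + a + d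
    identity = solve-∀

  xⁿ⁺¹-xⁿ : ℕ → Poly
  xⁿ⁺¹-xⁿ n = replicate n 0ℤ ++ (-1ℤ ∷ 1ℤ ∷ [])

  remainder₀ : 2 ℕ.≤ L → ∀ j → pcoef (toPoly (increment 0)) j ≡ pcoef (xⁿ⁺¹-xⁿ 0) j
  remainder₀ 2≤L j with j ℕ.<? L
  ... | yes j<L = trans (pcoef-applyUpTo-< (increment 0) L j j<L)
                        (trans (cong (λ x → 1ℤ * x + -1ℤ * e 0 j) (ρ≗e 1 2≤L j)) (e₁-e₀ j))
    where
    e₁-e₀ : ∀ j → 1ℤ * e 1 j + -1ℤ * e 0 j ≡ pcoef (xⁿ⁺¹-xⁿ 0) j
    e₁-e₀ zero          = refl
    e₁-e₀ (suc zero)    = refl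
    e₁-e₀ (suc (suc j)) = refl
  ... | no j≮L = trans (pcoef-applyUpTo-≥ (increment 0) L j (ℕₚ.≮⇒≥ j≮L)) (sym (high j (ℕₚ.≤-trans 2≤L (ℕₚ.≮⇒≥ j≮L))))
    where
    high : ∀ j → 2 ℕ.≤ j → pcoef (xⁿ⁺¹-xⁿ 0) j ≡ 0ℤ
    high (suc zero)    (s≤s ())
    high (suc (suc j)) _        = refl

  remainder : 2 ℕ.≤ L → ∀ n → ∃ λ Q → xⁿ⁺¹-xⁿ n ≈ₚ ((charPoly c *ₚ Q) +ₚ toPoly (increment n))
  remainder 2≤L zero = [] , λ j → sym (begin
    pcoef ((charPoly c *ₚ []) +ₚ toPoly (increment 0)) j        ≡⟨ pcoef-+ₚ (charPoly c *ₚ []) _ j ⟩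
    pcoef (charPoly c *ₚ []) j + pcoef (toPoly (increment 0)) j ≡⟨ cong₂ _+_ (pcoef-*ₚ-zero (charPoly c) [] (λ _ → refl) j) (remainder₀ 2≤L j) ⟩
    0ℤ + pcoef (xⁿ⁺¹-xⁿ 0) j                                    ≡⟨ ℤₚ.+-identityˡ _ ⟩
    pcoef (xⁿ⁺¹-xⁿ 0) j                                         ∎)
    where open ≡-Reasoning
  remainder 2≤L (suc n) with remainder 2≤L n
  ... | Q , rem = increment n (L ℕ.∸ 1) ∷ Q , λ j →
    trans (step-remainder (ℕₚ.<-trans (s≤s z≤n) 2≤L) (xⁿ⁺¹-xⁿ n) Q (increment n) rem j)
          (cong (λ p → pcoef ((charPoly c *ₚ (increment n (L ℕ.∸ 1) ∷ Q)) +ₚ p) j)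
                (applyUpTo-cong L (λ i _ → stepⁿ-ρ-comb 1 1ℤ -1ℤ n i)))

  -- b = (1, 0, …, 0, δ_{L-1}, …, δ₀) has charPoly b = x^{n+1} - x^n - Σ_{j<L} δ_j x^j,
  -- where δ = ρ_{n+1} - ρ_n.
  module FromIncrement (2≤L : 2 ℕ.≤ L) (n : ℕ) (L≤n : L ℕ.≤ n)
                       (0<Δ : ∀ j → j ℕ.< L → 0ℤ < increment n j) where

    Q : Poly
    Q = proj₁ (remainder 2≤L n)

    δ : ℕ → ℕ
    δ j = ℤ.∣ increment n j ∣

    K : ℕ
    K = n ℕ.∸ L

    low : List ℕ
    low = applyUpTo δ L ++ replicate K 0

    b : List ℕ
    b = reverse (low ++ 1 ∷ [])

    Δ tail : Poly
    Δ    = toPoly (increment n)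
    tail = replicate K 0ℤ ++ -1ℤ ∷ 1ℤ ∷ []

    b≡1∷ : b ≡ 1 ∷ reverse low
    b≡1∷ = Listₚ.reverse-++ low (1 ∷ [])

    0<δ₀ : 0 ℕ.< δ 0
    0<δ₀ = ℤₚ.drop‿+<+ (subst (0ℤ <_) (sym (ℤₚ.0≤i⇒+∣i∣≡i (ℤₚ.<⇒≤ 0<Δ₀))) 0<Δ₀)
      where
      0<Δ₀ : 0ℤ < increment n 0
      0<Δ₀ = 0<Δ 0 (ℕₚ.<-trans (s≤s z≤n) 2≤L)

    low++1≡δ₀∷ : low ++ 1 ∷ [] ≡ δ 0 ∷ (applyUpTo (δ ∘ suc) (ℕ.pred L) ++ replicate K 0) ++ 1 ∷ []
    low++1≡δ₀∷ = cong (λ k → (applyUpTo δ k ++ replicate K 0) ++ 1 ∷ [])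
                      (sym (ℕₚ.suc-pred L {{ℕ.>-nonZero (ℕₚ.<-trans (s≤s z≤n) 2≤L)}}))

    isPLRR : IsPLRR b
    isPLRR = record
      { M-pos  = subst (λ xs → 0 ℕ.< length xs) (sym b≡1∷) (s≤s z≤n)
      ; b₁-pos = subst (λ xs → 0 ℕ.< coef xs 1) (sym b≡1∷) (s≤s z≤n)
      ; bM-pos = subst (λ xs → 0 ℕ.< coef (reverse xs) (length (reverse xs))) (sym low++1≡δ₀∷)
          (subst (0 ℕ.<_) (sym (coef-reverse-length (δ 0) ((applyUpTo (δ ∘ suc) (ℕ.pred L) ++ replicate K 0) ++ 1 ∷ []))) 0<δ₀)
      }

    charPoly-b : charPoly b ≡ map -_ Δ ++ tail
    charPoly-b = begin
      charPoly b                                                       ≡⟨ charPoly-reverse (low ++ 1 ∷ []) ⟩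
      map neg+ (low ++ 1 ∷ []) ++ 1ℤ ∷ []                               ≡⟨ cong (_++ 1ℤ ∷ []) (Listₚ.map-++ neg+ low (1 ∷ [])) ⟩
      (map neg+ low ++ -1ℤ ∷ []) ++ 1ℤ ∷ []                             ≡⟨ Listₚ.++-assoc (map neg+ low) (-1ℤ ∷ []) (1ℤ ∷ []) ⟩
      map neg+ low ++ -1ℤ ∷ 1ℤ ∷ []                                     ≡⟨ cong (_++ -1ℤ ∷ 1ℤ ∷ []) (Listₚ.map-++ neg+ (applyUpTo δ L) (replicate K 0)) ⟩
      (map neg+ (applyUpTo δ L) ++ map neg+ (replicate K 0)) ++ -1ℤ ∷ 1ℤ ∷ []
        ≡⟨ Listₚ.++-assoc (map neg+ (applyUpTo δ L)) _ (-1ℤ ∷ 1ℤ ∷ []) ⟩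
      map neg+ (applyUpTo δ L) ++ map neg+ (replicate K 0) ++ -1ℤ ∷ 1ℤ ∷ []
        ≡⟨ cong₂ (λ xs ys → xs ++ ys ++ -1ℤ ∷ 1ℤ ∷ []) neg-δ (Listₚ.map-replicate neg+ K 0) ⟩
      map -_ Δ ++ tail                                                 ∎
      where
      open ≡-Reasoning
      neg-δ : map neg+ (applyUpTo δ L) ≡ map -_ Δ
      neg-δ = trans (Listₚ.map-applyUpTo δ neg+ L)
        (trans (applyUpTo-cong L (λ j j<L → cong -_ (ℤₚ.0≤i⇒+∣i∣≡i (ℤₚ.<⇒≤ (0<Δ j j<L)))))
               (sym (Listₚ.map-applyUpTo (increment n) -_ L)))

    xⁿ⁺¹-xⁿ≡ : xⁿ⁺¹-xⁿ n ≡ replicate L 0ℤ ++ tail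
    xⁿ⁺¹-xⁿ≡ = begin
      replicate n 0ℤ ++ -1ℤ ∷ 1ℤ ∷ []                     ≡⟨ cong (λ k → replicate k 0ℤ ++ -1ℤ ∷ 1ℤ ∷ []) (sym (ℕₚ.m+[n∸m]≡n L≤n)) ⟩
      replicate (L ℕ.+ K) 0ℤ ++ -1ℤ ∷ 1ℤ ∷ []             ≡⟨ cong (_++ -1ℤ ∷ 1ℤ ∷ []) (replicate-+ L K 0ℤ) ⟩
      (replicate L 0ℤ ++ replicate K 0ℤ) ++ -1ℤ ∷ 1ℤ ∷ [] ≡⟨ Listₚ.++-assoc (replicate L 0ℤ) (replicate K 0ℤ) _ ⟩
      replicate L 0ℤ ++ tail                              ∎
      where open ≡-Reasoning

    Pb≈PQ : charPoly b ≈ₚ (charPoly c *ₚ Q)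
    Pb≈PQ j = begin
      pcoef (charPoly b) j                             ≡⟨ cong (λ p → pcoef p j) charPoly-b ⟩
      pcoef (map -_ Δ ++ tail) j                       ≡⟨ pcoef-++-prefix (map -_ Δ) (replicate L 0ℤ) tail same-length j ⟩
      pcoef (replicate L 0ℤ ++ tail) j + (pcoef (map -_ Δ) j - pcoef (replicate L 0ℤ) j)
        ≡⟨ cong₂ (λ x y → pcoef x j + (y - pcoef (replicate L 0ℤ) j)) (sym xⁿ⁺¹-xⁿ≡) (pcoef-map-neg Δ j) ⟩
      pcoef (xⁿ⁺¹-xⁿ n) j + (- pcoef Δ j - pcoef (replicate L 0ℤ) j)
        ≡⟨ cong₂ (λ x y → x + (- pcoef Δ j - y)) (trans (proj₂ (remainder 2≤L n) j) (pcoef-+ₚ (charPoly c *ₚ Q) Δ j))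
                                                  (pcoef-replicate-0 L j) ⟩
      pcoef (charPoly c *ₚ Q) j + pcoef Δ j + (- pcoef Δ j - 0ℤ) ≡⟨ identity (pcoef (charPoly c *ₚ Q) j) (pcoef Δ j) ⟩
      pcoef (charPoly c *ₚ Q) j                        ∎
      where
      open ≡-Reasoning
      same-length : length (map -_ Δ) ≡ length (replicate L 0ℤ)
      same-length = trans (Listₚ.length-map -_ Δ) (trans (Listₚ.length-applyUpTo (increment n) L) (sym (Listₚ.length-replicate L)))
      identity : ∀ x d → x + d + (- d - 0ℤ) ≡ x
      identity = solve-∀

  plrr-from-increment : 2 ℕ.≤ L → ∀ n → L ℕ.≤ n → (∀ j → j ℕ.< L → 0ℤ < increment n j) →
                        Σ (List ℕ) λ b → IsPLRR b × DerivedFrom b c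
  plrr-from-increment 2≤L n L≤n 0<Δ = b , isPLRR , derivedFrom b c Q Pb≈PQ
    where open FromIncrement 2≤L n L≤n 0<Δ

-- Perron–Frobenius for the companion map

module Eventually (c : List ℕ) (0<L : 0 ℕ.< length c) (0<cL : 0 ℕ.< coef c (length c))
                  {F : ℕ} (sums≥F : ∀ n → F ℕ.≤ n → Sums.Sum (λ m → 0 ℕ.< coef c m) n) where

  open Companion c
  open Sums (λ m → 0 ℕ.< coef c m)

  L-1<L : L ℕ.∸ 1 ℕ.< L
  L-1<L = L∸1<L 0<L

  top-pos-Sum : ∀ {n} → Sum n → 1ℤ ≤ top (L ℕ.∸ 1 ℕ.+ n)
  top-pos-Sum [] = subst (λ k → 1ℤ ≤ top k) (sym (ℕₚ.+-identityʳ (L ℕ.∸ 1)))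
    (ℤₚ.≤-reflexive (sym (trans (ρ≗e (L ℕ.∸ 1) L-1<L (L ℕ.∸ 1)) (e-diagonal (L ℕ.∸ 1)))))
  top-pos-Sum (_∷_ {m} {n} 0<cₘ sn) with coef-pos⇒index c m 0<cₘ
  ... | s≤s z≤n , m≤L = ℤₚ.≤-trans (1≤*1≤ (top-pos-Sum sn) (ℤ.+≤+ 0<cₘ))
    (subst (λ k → top (L ℕ.∸ 1 ℕ.+ n) * + coef c m ≤ top k) (identity (L ℕ.∸ 1) n m)
           (top*coef≤top (L ℕ.∸ 1 ℕ.+ n) _ m≤L))
    where
    identity : ∀ a n m → a ℕ.+ n ℕ.+ m ≡ a ℕ.+ (m ℕ.+ n)
    identity = ℕ-solve-∀

  top-pos : ∀ m → L ℕ.∸ 1 ℕ.+ F ℕ.≤ m → 1ℤ ≤ top m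
  top-pos m L-1+F≤m = subst (λ k → 1ℤ ≤ top k) (ℕₚ.m+[n∸m]≡n (ℕₚ.≤-trans (ℕₚ.m≤m+n _ F) L-1+F≤m))
    (top-pos-Sum (sums≥F _ (ℕₚ.m+n≤o⇒m≤o∸n F (subst (ℕ._≤ m) (ℕₚ.+-comm _ F) L-1+F≤m))))

  -- The entry c_L feeds the top coordinate back into coordinate 0, which then shifts up.
  ρ-pos-from-top : ∀ m j → 1ℤ ≤ top m → 1ℤ ≤ ρ (j ℕ.+ suc m) j
  ρ-pos-from-top m j 1≤top = ℤₚ.≤-trans (ℤₚ.≤-trans (1≤*1≤ 1≤top (ℤ.+≤+ 0<cL)) (top*feedback≤ρ m 0))
    (subst (λ i → ρ (suc m) 0 ≤ ρ (j ℕ.+ suc m) i) (ℕₚ.+-identityʳ j) (ρ≤ρ-shiftⁱ j (suc m) 0))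

  N₊ : ℕ
  N₊ = L ℕ.+ (L ℕ.∸ 1 ℕ.+ F)

  ρ-pos : ∀ m j → j ℕ.< L → N₊ ℕ.≤ m → 1ℤ ≤ ρ m j
  ρ-pos m j j<L N₊≤m = subst (λ k → 1ℤ ≤ ρ k j) j+1+m′≡m (ρ-pos-from-top m′ j (top-pos m′ L-1+F≤m′))
    where
    m′ : ℕ
    m′ = m ℕ.∸ suc j
    j+1+m′≡m : j ℕ.+ suc m′ ≡ m
    j+1+m′≡m = trans (ℕₚ.+-suc j m′) (ℕₚ.m+[n∸m]≡n (ℕₚ.≤-trans j<L (ℕₚ.≤-trans (ℕₚ.m≤m+n L _) N₊≤m)))
    L-1+F≤m′ : L ℕ.∸ 1 ℕ.+ F ℕ.≤ m′
    L-1+F≤m′ = ℕₚ.≤-trans (ℕₚ.≤-reflexive (sym (ℕₚ.m+n∸m≡n L _)))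
                 (ℕₚ.≤-trans (ℕₚ.∸-monoˡ-≤ L N₊≤m) (ℕₚ.∸-monoʳ-≤ m j<L))

  stepᴺ-e-pos : ∀ i → i ℕ.< L → ∀ j → j ℕ.< L → 1ℤ ≤ stepⁿ N₊ (e i) j
  stepᴺ-e-pos i i<L j j<L = subst (1ℤ ≤_) ρ≡stepᴺe (ρ-pos (N₊ ℕ.+ i) j j<L (ℕₚ.m≤m+n N₊ i))
    where
    ρ≡stepᴺe : ρ (N₊ ℕ.+ i) j ≡ stepⁿ N₊ (e i) j
    ρ≡stepᴺe = trans (stepⁿ-+ N₊ i (e 0) j) (stepⁿ-cong N₊ (ρ≗e i i<L) j)

  -- σ - σᵢ eᵢ is still nonnegative, and stepⁿ N₊ (σᵢ eᵢ) ≥ σᵢ everywhere.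
  stepᴺ-dominates : ∀ σ → NonNeg σ → ∀ i → i ℕ.< L → ∀ j → j ℕ.< L → σ i ≤ stepⁿ N₊ σ j
  stepᴺ-dominates σ σ≥0 i i<L j j<L = begin
    σ i                                      ≡⟨ sym (ℤₚ.*-identityʳ (σ i)) ⟩
    σ i * 1ℤ                                 ≤⟨ *-monoˡ-≤-0≤ (σ≥0 i i<L) (stepᴺ-e-pos i i<L j j<L) ⟩
    σ i * stepⁿ N₊ (e i) j                   ≤⟨ ℤₚ.0≤i-j⇒j≤i (subst (0ℤ ≤_) split (stepⁿ-nonNeg N₊ rest≥0 j j<L)) ⟩
    stepⁿ N₊ σ j                             ∎
    where
    open ℤₚ.≤-Reasoning
    rest : State
    rest = lincomb 1ℤ σ (- σ i) (e i)
    split : stepⁿ N₊ rest j ≡ stepⁿ N₊ σ j - σ i * stepⁿ N₊ (e i) j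
    split = trans (stepⁿ-lincomb N₊ 1ℤ σ (- σ i) (e i) j) (identity (stepⁿ N₊ σ j) (σ i) (stepⁿ N₊ (e i) j))
      where
      identity : ∀ x s y → 1ℤ * x + (- s) * y ≡ x - s * y
      identity = solve-∀
    rest≥0 : NonNeg rest
    rest≥0 j′ j′<L with j′ ℕ.≟ i
    ... | yes refl = ℤₚ.≤-reflexive (sym (trans (cong (λ x → 1ℤ * σ i + (- σ i) * x) (e-diagonal i)) (identity (σ i))))
      where
      identity : ∀ x → 1ℤ * x + (- x) * 1ℤ ≡ 0ℤ
      identity = solve-∀
    ... | no j′≢i = subst (0ℤ ≤_) (sym (trans (cong (λ x → 1ℤ * σ j′ + (- σ i) * x) (e-≢ i j′ (j′≢i ∘ sym))) (identity (σ j′) (σ i))))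
                          (σ≥0 j′ j′<L)
      where
      identity : ∀ x y → 1ℤ * x + (- y) * 0ℤ ≡ x
      identity = solve-∀

  mass-≤-stepᴺ : ∀ σ → NonNeg σ → ∀ j → j ℕ.< L → mass σ ≤ + L * stepⁿ N₊ σ j
  mass-≤-stepᴺ σ σ≥0 j j<L = Σ<-≤-* σ (stepⁿ N₊ σ j) L (λ i i<L → stepᴺ-dominates σ σ≥0 i i<L j j<L)

  stepⁿ-≤-mass : ∀ m σ → NonNeg σ → ∀ j → j ℕ.< L → stepⁿ m σ j ≤ mass σ * G ^ m
  stepⁿ-≤-mass m σ σ≥0 = stepⁿ-bounded m σ≥0 (≤-Σ< σ L σ≥0)

  Λ : ℤ
  Λ = G ^ N₊

  Λ-0≤ : 0ℤ ≤ Λ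
  Λ-0≤ = ^-0≤ N₊ (0≤+ _)

  r : ℤ
  r = + 2 * + L * Λ

  r-0≤ : 0ℤ ≤ r
  r-0≤ = 0≤*0≤ (0≤*0≤ (0≤+ 2) (0≤+ L)) Λ-0≤

  Lower Upper : ℕ → ℤ → ℤ → Set
  Lower n D p = NonNeg (ρ-comb (D - p) (- D) n)
  Upper n D P = NonNeg (ρ-comb (P - D) D n)

  -- Coordinatewise  p ρ_{n+1} ≤ D (ρ_{n+1} - ρ_n) ≤ P ρ_{n+1}:  the growth ratio
  -- 1 - ρ_n/ρ_{n+1} of every coordinate lies in the interval [p/D, P/D].
  Bracket : ℕ → ℤ → ℤ → ℤ → Set
  Bracket n D p P = Lower n D p × Upper n D P

  -- After N₊ steps every entry of y = ρ-comb a b n is at least (mass y)/L, and every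
  -- entry of ρ_{n+1} at most Λ · mass ρ_{n+1}; this is where r = 2 L Λ comes from.
  absorb : ∀ a b n W → 0ℤ ≤ W → NonNeg (ρ-comb a b n) →
           W * mass (ρ (suc n)) ≤ + 2 * mass (ρ-comb a b n) →
           ∀ j → j ℕ.< L → W * ρ (suc (N₊ ℕ.+ n)) j ≤ r * ρ-comb a b (N₊ ℕ.+ n) j
  absorb a b n W 0≤W y≥0 WSr≤2S j j<L = begin
    W * ρ (suc (N₊ ℕ.+ n)) j         ≤⟨ *-monoˡ-≤-0≤ 0≤W ρ≤SrΛ ⟩
    W * (Sr * Λ)                     ≡⟨ sym (ℤₚ.*-assoc W Sr Λ) ⟩
    W * Sr * Λ                       ≤⟨ *-monoʳ-≤-0≤ Λ-0≤ WSr≤2S ⟩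
    + 2 * S * Λ                      ≡⟨ identity S Λ ⟩
    (+ 2 * Λ) * S                    ≤⟨ *-monoˡ-≤-0≤ (0≤*0≤ (0≤+ 2) Λ-0≤) S≤Ly ⟩
    (+ 2 * Λ) * (+ L * y)            ≡⟨ identity′ Λ (+ L) y ⟩
    r * y                            ∎
    where
    open ℤₚ.≤-Reasoning
    S : ℤ
    S = mass (ρ-comb a b n)
    Sr : ℤ
    Sr = mass (ρ (suc n))
    y : ℤ
    y = ρ-comb a b (N₊ ℕ.+ n) j
    ρ≤SrΛ : ρ (suc (N₊ ℕ.+ n)) j ≤ Sr * Λ
    ρ≤SrΛ = subst (_≤ Sr * Λ)
      (trans (sym (stepⁿ-+ N₊ (suc n) (e 0) j)) (cong (λ k → ρ k j) (ℕₚ.+-suc N₊ n)))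
      (stepⁿ-≤-mass N₊ (ρ (suc n)) (ρ-nonNeg (suc n)) j j<L)
    S≤Ly : S ≤ + L * y
    S≤Ly = subst (λ x → S ≤ + L * x) (stepⁿ-ρ-comb N₊ a b n j) (mass-≤-stepᴺ (ρ-comb a b n) y≥0 j j<L)
    identity : ∀ S Λ → + 2 * S * Λ ≡ (+ 2 * Λ) * S
    identity = solve-∀
    identity′ : ∀ Λ L y → (+ 2 * Λ) * (L * y) ≡ + 2 * L * Λ * y
    identity′ = solve-∀

  scaled-nonNeg : ∀ a b n → NonNeg (ρ-comb a b n) → ∀ j → j ℕ.< L → 0ℤ ≤ r * ρ-comb a b (N₊ ℕ.+ n) j
  scaled-nonNeg a b n ≥0 j j<L = 0≤*0≤ r-0≤ (ρ-comb-nonNeg N₊ a b n ≥0 j j<L)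

  lower-scale : ∀ n D p → Lower n D p → Lower (N₊ ℕ.+ n) (r * D) (r * p)
  lower-scale n D p lower j j<L = subst (0ℤ ≤_) (sym (identity r D p (ρ (suc (N₊ ℕ.+ n)) j) (ρ (N₊ ℕ.+ n) j)))
    (scaled-nonNeg (D - p) (- D) n lower j j<L)
    where
    identity : ∀ r D p x y → (r * D - r * p) * x + (- (r * D)) * y ≡ r * ((D - p) * x + (- D) * y)
    identity = solve-∀

  upper-scale : ∀ n D P → Upper n D P → Upper (N₊ ℕ.+ n) (r * D) (r * P)
  upper-scale n D P upper j j<L = subst (0ℤ ≤_) (sym (identity r D P (ρ (suc (N₊ ℕ.+ n)) j) (ρ (N₊ ℕ.+ n) j)))
    (scaled-nonNeg (P - D) D n upper j j<L)
    where
    identity : ∀ r D P x y → (r * P - r * D) * x + (r * D) * y ≡ r * ((P - D) * x + D * y)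
    identity = solve-∀

  lower-absorb : ∀ n D p W → 0ℤ ≤ W → Lower n D p →
                 W * mass (ρ (suc n)) ≤ + 2 * mass (ρ-comb (D - p) (- D) n) →
                 Lower (N₊ ℕ.+ n) (r * D) (r * p + W)
  lower-absorb n D p W 0≤W lower WSr≤2S j j<L =
    subst (0ℤ ≤_) (sym (identity r D p W (ρ (suc (N₊ ℕ.+ n)) j) (ρ (N₊ ℕ.+ n) j)))
      (ℤₚ.i≤j⇒0≤j-i (absorb (D - p) (- D) n W 0≤W lower WSr≤2S j j<L))
    where
    identity : ∀ r D p W x y → (r * D - (r * p + W)) * x + (- (r * D)) * y ≡ r * ((D - p) * x + (- D) * y) - W * x
    identity = solve-∀

  upper-absorb : ∀ n D P W → 0ℤ ≤ W → Upper n D P →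
                 W * mass (ρ (suc n)) ≤ + 2 * mass (ρ-comb (P - D) D n) →
                 Upper (N₊ ℕ.+ n) (r * D) (r * P - W)
  upper-absorb n D P W 0≤W upper WSr≤2S j j<L =
    subst (0ℤ ≤_) (sym (identity r D P W (ρ (suc (N₊ ℕ.+ n)) j) (ρ (N₊ ℕ.+ n) j)))
      (ℤₚ.i≤j⇒0≤j-i (absorb (P - D) D n W 0≤W upper WSr≤2S j j<L))
    where
    identity : ∀ r D P W x y → (r * P - W - r * D) * x + (r * D) * y ≡ r * ((P - D) * x + D * y) - W * x
    identity = solve-∀

  -- The two sides of a bracket have total mass (P - p) · mass ρ_{n+1}, so one of them
  -- carries at least half of it and can absorb a shrinking of the bracket by P - p.
  bracket-refine : ∀ n D p P → 0ℤ ≤ P - p → Bracket n D p P →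
    Bracket (N₊ ℕ.+ n) (r * D) (r * p + (P - p)) (r * P) ⊎
    Bracket (N₊ ℕ.+ n) (r * D) (r * p) (r * P - (P - p))
  bracket-refine n D p P 0≤W (lower , upper) with (P - p) * mass (ρ (suc n)) ℤₚ.≤? + 2 * mass (ρ-comb (D - p) (- D) n)
  ... | yes WSr≤2Sy = inj₁ (lower-absorb n D p (P - p) 0≤W lower WSr≤2Sy , upper-scale n D P upper)
  ... | no  WSr≰2Sy = inj₂ (lower-scale n D p lower , upper-absorb n D P (P - p) 0≤W upper WSr≤2Sz)
    where
    Sr : ℤ
    Sr = mass (ρ (suc n))
    Sy : ℤ
    Sy = mass (ρ-comb (D - p) (- D) n)
    Sz : ℤ
    Sz = mass (ρ-comb (P - D) D n)
    Sy+Sz≡WSr : Sy + Sz ≡ (P - p) * Sr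
    Sy+Sz≡WSr = trans (cong₂ _+_ (Σ<-linear (D - p) (ρ (suc n)) (- D) (ρ n) L) (Σ<-linear (P - D) (ρ (suc n)) D (ρ n) L))
                      (identity D p P Sr (mass (ρ n)))
      where
      identity : ∀ D p P a b → (D - p) * a + (- D) * b + ((P - D) * a + D * b) ≡ (P - p) * a
      identity = solve-∀
    WSr≤2Sz : (P - p) * Sr ≤ + 2 * Sz
    WSr≤2Sz = ℤₚ.0≤i-j⇒j≤i (subst (0ℤ ≤_) (identity Sy Sz _ Sy+Sz≡WSr) (ℤₚ.<⇒≤ (i<j⇒0<j-i (ℤₚ.≰⇒> WSr≰2Sy))))
      where
      identity : ∀ Sy Sz WSr → Sy + Sz ≡ WSr → WSr - + 2 * Sy ≡ + 2 * Sz - WSr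
      identity Sy Sz _ refl = rearrange Sy Sz
        where
        rearrange : ∀ Sy Sz → Sy + Sz - + 2 * Sy ≡ + 2 * Sz - (Sy + Sz)
        rearrange = solve-∀
  module InnerCoefficient (q r′ : ℕ) (L≡ : L ≡ suc q ℕ.+ suc r′) (0<c₁₊q : 0 ℕ.< coef c (suc q)) where

    κ : ℤ
    κ = + (2 ℕ.* L)

    1≤κ : 1ℤ ≤ κ
    1≤κ = ℤ.+≤+ (ℕₚ.≤-trans 0<L (ℕₚ.m≤m+n L _))

    0≤κ : 0ℤ ≤ κ
    0≤κ = 0≤+ _

    0≤κ-1 : 0ℤ ≤ κ - 1ℤ
    0≤κ-1 = ℤₚ.i≤j⇒0≤j-i 1≤κ

    SlowFrom : ℕ → Set
    SlowFrom a = ∀ i → a ℕ.≤ i → (κ - 1ℤ) * top (suc i) ≤ κ * top i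

    slow-iterate : ∀ a → SlowFrom a → ∀ m → (κ - 1ℤ) ^ m * top (a ℕ.+ m) ≤ κ ^ m * top a
    slow-iterate a slow zero    = subst (λ k → 1ℤ * top k ≤ 1ℤ * top a) (sym (ℕₚ.+-identityʳ a)) ℤₚ.≤-refl
    slow-iterate a slow (suc m) = subst (λ k → (κ - 1ℤ) ^ suc m * top k ≤ κ ^ suc m * top a) (sym (ℕₚ.+-suc a m)) (begin
      (κ - 1ℤ) * (κ - 1ℤ) ^ m * top (suc (a ℕ.+ m)) ≡⟨ identity (κ - 1ℤ) ((κ - 1ℤ) ^ m) (top (suc (a ℕ.+ m))) ⟩
      (κ - 1ℤ) ^ m * ((κ - 1ℤ) * top (suc (a ℕ.+ m))) ≤⟨ *-monoˡ-≤-0≤ (^-0≤ m 0≤κ-1) (slow (a ℕ.+ m) (ℕₚ.m≤m+n a m)) ⟩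
      (κ - 1ℤ) ^ m * (κ * top (a ℕ.+ m))          ≡⟨ identity′ κ ((κ - 1ℤ) ^ m) (top (a ℕ.+ m)) ⟩
      κ * ((κ - 1ℤ) ^ m * top (a ℕ.+ m))          ≤⟨ *-monoˡ-≤-0≤ 0≤κ (slow-iterate a slow m) ⟩
      κ * (κ ^ m * top a)                         ≡⟨ sym (ℤₚ.*-assoc κ (κ ^ m) (top a)) ⟩
      κ * κ ^ m * top a                           ∎)
      where
      open ℤₚ.≤-Reasoning
      identity : ∀ x p y → x * p * y ≡ p * (x * y)
      identity = solve-∀
      identity′ : ∀ x p y → p * (x * y) ≡ x * (p * y)
      identity′ = solve-∀

    -- With A = top (n + L), t₁ = top (n + 1 + r′), t₀ = top n: slow growth and
    -- Bernoulli give t₁ ≥ (1 - (q + 1)/κ) A and t₀ ≥ (1 - L/κ) A, while the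
    -- recurrence gives A ≥ t₁ + t₀; impossible since q + 1 + L < κ.
    module Slow (n : ℕ) (N₊≤n : N₊ ℕ.≤ n) (slow : SlowFrom n) where

      t₀ t₁ A a₁ b₁ e₁ eL : ℤ
      t₀ = top n
      t₁ = top (n ℕ.+ suc r′)
      A  = top (n ℕ.+ L)
      a₁ = κ ^ suc r′
      b₁ = κ ^ suc q
      e₁ = (κ - 1ℤ) ^ suc q
      eL = (κ - 1ℤ) ^ L

      κ^L≡b₁a₁ : κ ^ L ≡ b₁ * a₁
      κ^L≡b₁a₁ = trans (cong (κ ^_) L≡) (ℤₚ.^-distribˡ-+-* κ (suc q) (suc r′))

      1≤A : 1ℤ ≤ A
      1≤A = ρ-pos (n ℕ.+ L) (L ℕ.∸ 1) L-1<L (ℕₚ.≤-trans N₊≤n (ℕₚ.m≤m+n n L))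

      recurrence : 0ℤ ≤ A - t₁ - t₀
      recurrence = subst (0ℤ ≤_) (identity A t₁ t₀) (ℤₚ.i≤j⇒0≤j-i (ℤₚ.≤-trans
          (ℤₚ.+-mono-≤ (≤*coef t₁ _ (ρ-0≤ (n ℕ.+ suc r′) _) 0<c₁₊q) (≤*coef t₀ _ (ρ-0≤ n _) 0<cL))
          (top-two-terms≤top n q r′ L≡)))
        where
        ≤*coef : ∀ x m → 0ℤ ≤ x → 0 ℕ.< m → x ≤ x * + m
        ≤*coef x m 0≤x 0<m = subst (_≤ x * + m) (ℤₚ.*-identityʳ x) (*-monoˡ-≤-0≤ 0≤x (ℤ.+≤+ 0<m))
        identity : ∀ A a b → A - (a + b) ≡ A - a - b
        identity = solve-∀

      slow₁ : 0ℤ ≤ b₁ * t₁ - e₁ * A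
      slow₁ = ℤₚ.i≤j⇒0≤j-i (subst (λ k → e₁ * top k ≤ b₁ * t₁) n+1+r′+1+q≡n+L
        (slow-iterate (n ℕ.+ suc r′) (λ i n+1+r′≤i → slow i (ℕₚ.≤-trans (ℕₚ.m≤m+n n (suc r′)) n+1+r′≤i)) (suc q)))
        where
        n+1+r′+1+q≡n+L : n ℕ.+ suc r′ ℕ.+ suc q ≡ n ℕ.+ L
        n+1+r′+1+q≡n+L = trans (ℕₚ.+-assoc n (suc r′) (suc q)) (cong (n ℕ.+_) (trans (ℕₚ.+-comm (suc r′) (suc q)) (sym L≡)))

      slow₀ : 0ℤ ≤ b₁ * a₁ * t₀ - eL * A
      slow₀ = ℤₚ.i≤j⇒0≤j-i (subst (λ x → eL * A ≤ x * t₀) κ^L≡b₁a₁ (slow-iterate n slow L))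

      bernoulli₁ : 0ℤ ≤ κ * e₁ + + suc q * b₁ - κ * b₁
      bernoulli₁ = ℤₚ.i≤j⇒0≤j-i (bernoulli-minus κ (suc q) 1≤κ)

      bernoulliL : 0ℤ ≤ κ * eL + + L * (b₁ * a₁) - κ * (b₁ * a₁)
      bernoulliL = ℤₚ.i≤j⇒0≤j-i (subst (λ x → κ * x ≤ κ * eL + + L * x) κ^L≡b₁a₁ (bernoulli-minus κ L 1≤κ))

      room : 0ℤ ≤ κ - 1ℤ - + suc q - + L
      room = subst (0ℤ ≤_) κ-[1+q+L+1]≡ (ℤₚ.i≤j⇒0≤j-i (ℤ.+≤+ 1+q+L+1≤2L))
        where
        1+q+L+1≤2L : suc q ℕ.+ L ℕ.+ 1 ℕ.≤ 2 ℕ.* L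
        1+q+L+1≤2L = subst₂ ℕ._≤_ (identity (suc q) L) (identity′ L)
          (ℕₚ.+-monoˡ-≤ L (subst (suc q ℕ.+ 1 ℕ.≤_) (sym L≡) (ℕₚ.+-monoʳ-≤ (suc q) (s≤s z≤n))))
          where
          identity : ∀ a b → a ℕ.+ 1 ℕ.+ b ≡ a ℕ.+ b ℕ.+ 1
          identity = ℕ-solve-∀
          identity′ : ∀ b → b ℕ.+ b ≡ 2 ℕ.* b
          identity′ = ℕ-solve-∀
        κ-[1+q+L+1]≡ : κ - + (suc q ℕ.+ L ℕ.+ 1) ≡ κ - 1ℤ - + suc q - + L
        κ-[1+q+L+1]≡ = trans (cong (λ x → κ - x) (trans (ℤₚ.pos-+ (suc q ℕ.+ L) 1) (cong (_+ 1ℤ) (ℤₚ.pos-+ (suc q) L))))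
                             (identity κ (+ suc q) (+ L))
          where
          identity : ∀ k a b → k - (a + b + 1ℤ) ≡ k - 1ℤ - a - b
          identity = solve-∀

      -- A nonnegative combination of the six facts above.
      -AΠ≥0 : 0ℤ ≤ - (A * (b₁ * a₁))
      -AΠ≥0 = subst (0ℤ ≤_) (identity κ b₁ a₁ A t₁ t₀ e₁ eL (+ suc q) (+ L))
        (0≤+0≤ (0≤+0≤ (0≤+0≤ (0≤+0≤ (0≤+0≤
          (0≤*0≤ (0≤*0≤ 0≤κ 0≤b₁a₁) recurrence)
          (0≤*0≤ (0≤*0≤ 0≤κ 0≤a₁) slow₁))
          (0≤*0≤ 0≤κ slow₀))
          (0≤*0≤ (0≤*0≤ 0≤a₁ 0≤A) bernoulli₁))
          (0≤*0≤ 0≤A bernoulliL))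
          (0≤*0≤ (0≤*0≤ 0≤b₁a₁ 0≤A) room))
        where
        0≤A : 0ℤ ≤ A
        0≤A = ℤₚ.≤-trans (0≤+ 1) 1≤A
        0≤a₁ : 0ℤ ≤ a₁
        0≤a₁ = ^-0≤ (suc r′) 0≤κ
        0≤b₁a₁ : 0ℤ ≤ b₁ * a₁
        0≤b₁a₁ = 0≤*0≤ (^-0≤ (suc q) 0≤κ) 0≤a₁
        identity : ∀ κ b₁ a₁ A t₁ t₀ e₁ eL sq L →
          κ * (b₁ * a₁) * (A - t₁ - t₀) + κ * a₁ * (b₁ * t₁ - e₁ * A) + κ * (b₁ * a₁ * t₀ - eL * A)
          + a₁ * A * (κ * e₁ + sq * b₁ - κ * b₁) + A * (κ * eL + L * (b₁ * a₁) - κ * (b₁ * a₁))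
          + b₁ * a₁ * A * (κ - 1ℤ - sq - L) ≡ - (A * (b₁ * a₁))
        identity = solve-∀

      -AΠ<0 : - (A * (b₁ * a₁)) < 0ℤ
      -AΠ<0 = ℤₚ.neg-mono-< (ℤₚ.<-≤-trans (ℤ.+<+ (s≤s z≤n)) (1≤*1≤ 1≤A (1≤*1≤ (^-1≤ (suc q) 1≤κ) (^-1≤ (suc r′) 1≤κ))))

    never-slow : ∀ n → N₊ ℕ.≤ n → ¬ SlowFrom n
    never-slow n N₊≤n slow = ℤₚ.<-irrefl refl (ℤₚ.≤-<-trans -AΠ≥0 -AΠ<0)
      where open Slow n N₊≤n slow

    bracket-upper : ∀ n D p P → N₊ ℕ.≤ n → 0ℤ < D → Bracket n D p P → D ≤ κ * P
    bracket-upper n D p P N₊≤n 0<D (_ , upper) = ℤₚ.≮⇒≥ λ κP<D → never-slow n N₊≤n (slow κP<D)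
      where
      slow : κ * P < D → SlowFrom n
      slow κP<D i n≤i = ℤₚ.0≤i-j⇒j≤i (0≤*⇒0≤ 0<D (subst (0ℤ ≤_) (identity κ P D (top (suc i)) (top i))
          (0≤+0≤ (0≤*0≤ 0≤κ upperᵢ) (0≤*0≤ (ℤₚ.<⇒≤ (i<j⇒0<j-i κP<D)) (ρ-0≤ (suc i) (L ℕ.∸ 1))))))
        where
        upperᵢ : 0ℤ ≤ (P - D) * top (suc i) + D * top i
        upperᵢ = subst (λ k → 0ℤ ≤ (P - D) * ρ (suc k) (L ℕ.∸ 1) + D * ρ k (L ℕ.∸ 1)) (ℕₚ.m∸n+n≡m n≤i)
                   (ρ-comb-nonNeg (i ℕ.∸ n) (P - D) D n upper (L ℕ.∸ 1) L-1<L)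
        identity : ∀ κ P D T′ T → κ * ((P - D) * T′ + D * T) + (D - κ * P) * T′ ≡ D * (κ * T - (κ - 1ℤ) * T′)
        identity = solve-∀

    W₀ : ℤ
    W₀ = + L * Λ

    0≤W₀ : 0ℤ ≤ W₀
    0≤W₀ = 0≤*0≤ (0≤+ L) Λ-0≤

    bracket₀ : Bracket N₊ 1ℤ (1ℤ - W₀) 1ℤ
    bracket₀ = lower , upper
      where
      lower : Lower N₊ 1ℤ (1ℤ - W₀)
      lower j j<L = subst (0ℤ ≤_) (sym (identity (+ L) Λ (ρ (suc N₊) j) (ρ N₊ j)))
                      (0≤+0≤ (0≤*0≤ Λ-0≤ (ℤₚ.i≤j⇒0≤j-i 1≤Lρ)) (ℤₚ.i≤j⇒0≤j-i ρ≤Λ))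
        where
        identity : ∀ L Λ x y → (1ℤ - (1ℤ - L * Λ)) * x + (- 1ℤ) * y ≡ Λ * (L * x - 1ℤ) + (Λ - y)
        identity = solve-∀
        1≤Lρ : 1ℤ ≤ + L * ρ (suc N₊) j
        1≤Lρ = 1≤*1≤ (ℤ.+≤+ 0<L) (ρ-pos (suc N₊) j j<L (ℕₚ.n≤1+n N₊))
        e₀≤1 : BoundedBy 1ℤ (e 0)
        e₀≤1 zero    _ = ℤₚ.≤-refl
        e₀≤1 (suc j) _ = 0≤+ 1
        ρ≤Λ : ρ N₊ j ≤ Λ
        ρ≤Λ = subst (ρ N₊ j ≤_) (ℤₚ.*-identityˡ Λ) (stepⁿ-bounded N₊ (ρ-nonNeg 0) e₀≤1 j j<L)
      upper : Upper N₊ 1ℤ 1ℤ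
      upper j _ = subst (0ℤ ≤_) (sym (identity (ρ (suc N₊) j) (ρ N₊ j))) (ρ-0≤ N₊ j)
        where
        identity : ∀ x y → (1ℤ - 1ℤ) * x + 1ℤ * y ≡ y
        identity = solve-∀

    N[_] : ℕ → ℕ
    N[ zero  ] = N₊
    N[ suc T ] = N₊ ℕ.+ N[ T ]

    N₊≤N[_] : ∀ T → N₊ ℕ.≤ N[ T ]
    N₊≤N[ zero  ] = ℕₚ.≤-refl
    N₊≤N[ suc T ] = ℕₚ.m≤m+n N₊ N[ T ]

    1≤Λ : 1ℤ ≤ Λ
    1≤Λ = ^-1≤ N₊ (i≤i+0≤ (0≤+ _))

    2≤r : + 2 ≤ r
    2≤r = subst (_≤ r) (ℤₚ.*-identityʳ (+ 2)) (*-mono-≤-0≤ (0≤+ 2) 2≤2L (0≤+ 1) 1≤Λ)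
      where
      2≤2L : + 2 ≤ + 2 * + L
      2≤2L = subst (_≤ + 2 * + L) (ℤₚ.*-identityʳ (+ 2)) (*-monoˡ-≤-0≤ (0≤+ 2) (ℤ.+≤+ 0<L))

    1≤r-1 : 1ℤ ≤ r - 1ℤ
    1≤r-1 = ℤₚ.0≤i-j⇒j≤i (subst (0ℤ ≤_) (identity r) (ℤₚ.i≤j⇒0≤j-i 2≤r))
      where
      identity : ∀ r → r - + 2 ≡ r - 1ℤ - 1ℤ
      identity = solve-∀

    0≤r-1 : 0ℤ ≤ r - 1ℤ
    0≤r-1 = ℤₚ.≤-trans (0≤+ 1) 1≤r-1

    width-step : ∀ {w} T → w ≡ W₀ * (r - 1ℤ) ^ T → (r - 1ℤ) * w ≡ W₀ * (r - 1ℤ) ^ suc T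
    width-step T refl = identity (r - 1ℤ) W₀ ((r - 1ℤ) ^ T)
      where
      identity : ∀ a W b → a * (W * b) ≡ W * (a * b)
      identity = solve-∀

    bracket-iterate : ∀ T → ∃ λ p → ∃ λ P → P - p ≡ W₀ * (r - 1ℤ) ^ T × Bracket N[ T ] (r ^ T) p P
    bracket-iterate zero = 1ℤ - W₀ , 1ℤ , identity W₀ , bracket₀
      where
      identity : ∀ W → 1ℤ - (1ℤ - W) ≡ W * 1ℤ
      identity = solve-∀
    bracket-iterate (suc T) with bracket-iterate T
    ... | p , P , width , bracket
        with bracket-refine N[ T ] (r ^ T) p P (subst (0ℤ ≤_) (sym width) (0≤*0≤ 0≤W₀ (^-0≤ T 0≤r-1))) bracket
    ... | inj₁ refined = r * p + (P - p) , r * P , trans (identity r P p) (width-step T width) , refined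
      where
      identity : ∀ r P p → r * P - (r * p + (P - p)) ≡ (r - 1ℤ) * (P - p)
      identity = solve-∀
    ... | inj₂ refined = r * p , r * P - (P - p) , trans (identity r P p) (width-step T width) , refined
      where
      identity : ∀ r P p → r * P - (P - p) - r * p ≡ (r - 1ℤ) * (P - p)
      identity = solve-∀

    T* : ℕ
    T* = ℤ.∣ κ * W₀ * (r - 1ℤ) ∣

    -- Bernoulli: (r/(r-1))^T ≥ 1 + T/(r-1) = 1 + κ W₀ for T = T*.
    width-small : κ * (W₀ * (r - 1ℤ) ^ T*) < r ^ T*
    width-small = ℤₚ.*-cancelˡ-<-nonNeg (r - 1ℤ) {{ℤ.nonNegative 0≤r-1}} (begin-strict
      s * X                          ≡⟨ sym (ℤₚ.+-identityʳ (s * X)) ⟩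
      s * X + 0ℤ                     <⟨ ℤₚ.+-monoʳ-< (s * X) 0<sᵀs ⟩
      s * X + s ^ T* * s             ≡⟨ trans (identity s κ W₀ (s ^ T*)) (cong (λ t → s ^ T* * (s + t)) (sym +T*≡)) ⟩
      s ^ T* * (s + + T*)            ≤⟨ bernoulli-plus s T* 0≤r-1 ⟩
      (s + 1ℤ) ^ T* * s              ≡⟨ trans (cong (λ x → x ^ T* * s) (identity′ r)) (ℤₚ.*-comm (r ^ T*) s) ⟩
      s * r ^ T*                     ∎)
      where
      open ℤₚ.≤-Reasoning
      s : ℤ
      s = r - 1ℤ
      X : ℤ
      X = κ * (W₀ * s ^ T*)
      +T*≡ : + T* ≡ κ * W₀ * s
      +T*≡ = ℤₚ.0≤i⇒+∣i∣≡i (0≤*0≤ (0≤*0≤ 0≤κ 0≤W₀) 0≤r-1)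
      0<sᵀs : 0ℤ < s ^ T* * s
      0<sᵀs = ℤₚ.<-≤-trans (ℤ.+<+ (s≤s z≤n)) (1≤*1≤ (^-1≤ T* 1≤r-1) 1≤r-1)
      identity : ∀ s k W p → s * (k * (W * p)) + p * s ≡ p * (s + k * W * s)
      identity = solve-∀
      identity′ : ∀ r → r - 1ℤ + 1ℤ ≡ r
      identity′ = solve-∀

    eventually-increasing : ∃ λ n → N₊ ℕ.≤ n × (∀ j → j ℕ.< L → 0ℤ < increment n j)
    eventually-increasing with bracket-iterate T*
    ... | p , P , width , bracket@(lower , _) = N[ T* ] , N₊≤N[ T* ] , increasing
      where
      n : ℕ
      n = N[ T* ]
      D : ℤ
      D = r ^ T*
      0<D : 0ℤ < D
      0<D = ℤₚ.<-≤-trans (ℤ.+<+ (s≤s z≤n)) (^-1≤ T* (ℤₚ.≤-trans (ℤ.+≤+ (s≤s z≤n)) 2≤r))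
      0<κp : 0ℤ < κ * p
      0<κp = subst (0ℤ <_) (identity κ P p) (i<j⇒0<j-i (ℤₚ.<-≤-trans
        (subst (λ w → κ * w < D) (sym width) width-small) (bracket-upper n D p P (N₊≤N[ T* ]) 0<D bracket)))
        where
        identity : ∀ k P p → k * P - k * (P - p) ≡ k * p
        identity = solve-∀
      0<p : 0ℤ < p
      0<p = 0<*⇒0< (ℤₚ.<-≤-trans (ℤ.+<+ (s≤s z≤n)) 1≤κ) 0<κp
      increasing : ∀ j → j ℕ.< L → 0ℤ < increment n j
      increasing j j<L = 0<*⇒0< 0<D (ℤₚ.<-≤-trans 0<pρ (ℤₚ.0≤i-j⇒j≤i
        (subst (0ℤ ≤_) (identity D p (ρ (suc n) j) (ρ n j)) (lower j j<L))))
        where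
        identity : ∀ D p x y → (D - p) * x + (- D) * y ≡ D * (1ℤ * x + -1ℤ * y) - p * x
        identity = solve-∀
        0<pρ : 0ℤ < p * ρ (suc n) j
        0<pρ = ℤₚ.<-≤-trans 0<p (subst (_≤ p * ρ (suc n) j) (ℤₚ.*-identityʳ p)
          (*-monoˡ-≤-0≤ (ℤₚ.<⇒≤ 0<p) (ρ-pos (suc n) j j<L (ℕₚ.≤-trans N₊≤N[ T* ] (ℕₚ.n≤1+n n)))))

plrr-of-shallow : ∀ c → IsZLRR 0 c → Σ (List ℕ) λ b → IsPLRR b × DerivedFrom b c
plrr-of-shallow c zlrr = c , isPLRR , derivedFrom c c (1ℤ ∷ []) (λ k → sym (pcoef-*ₚ-1 (charPoly c) k))
  where
  open IsZLRR zlrr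
  isPLRR : IsPLRR c
  isPLRR = record { M-pos = L-pos ; b₁-pos = cs+1-pos ; bM-pos = cL-pos }

module Deep (s : ℕ) (c : List ℕ) (zlrr : IsZLRR (suc s) c) where

  open IsZLRR zlrr
  open Sums (λ m → 0 ℕ.< coef c m)
  open Companion c using (L; increment)
  open Remainder c using (plrr-from-increment)

  2≤L : 2 ℕ.≤ L
  2≤L = ℕₚ.≤-trans (s≤s (s≤s z≤n)) s<L

  gcd-witness : ∃ λ A → ∃ λ B → Sum A × Sum B × A ≡ B ℕ.+ 1
  gcd-witness with Sum-bézout (support c) support-pos
    where
    support-pos : All (λ m → 0 ℕ.< coef c m) (support c)
    support-pos = All.map ℕₚ.n≢0⇒n>0 (all-filter (λ m → ¬? (coef c m ℕ.≟ 0)) (oneTo L))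
  ... | A , B , sA , sB , A≡B+g = A , B , sA , sB , trans A≡B+g (cong (B ℕ.+_) gcd-one)

  sums≥ : ∃ λ F → ∀ n → F ℕ.≤ n → Sum n
  sums≥ with gcd-witness
  ... | A , B , sA , sB , A≡B+1 = B ℕ.* B , Sum-≥B² sA sB A≡B+1

  -- Otherwise c_L would be the only nonzero coefficient, and gcd S = L ≥ 2.
  2+s<L : suc (suc s) ℕ.< L
  2+s<L = ℕₚ.≤∧≢⇒< s<L 2+s≢L
    where
    2+s≢L : suc (suc s) ≢ L
    2+s≢L 2+s≡L with gcd-witness
    ... | A , B , sA , sB , A≡B+1 = ℕₚ.<⇒≢ 2≤L (sym (∣1⇒≡1 (∣m+n∣m⇒∣n (subst (L ∣_) A≡B+1 (Sum-∣ L∣part sA)) (Sum-∣ L∣part sB))))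
      where
      L∣part : ∀ {m} → 0 ℕ.< coef c m → L ∣ m
      L∣part {m} 0<cₘ with coef-pos⇒index c m 0<cₘ | m ℕ.≤? suc s
      ... | 0<m , _   | yes m≤1+s = ⊥-elim (ℕₚ.<⇒≢ 0<cₘ (sym (zeros m 0<m m≤1+s)))
      ... | _   , m≤L | no m≰1+s  = ∣-reflexive (ℕₚ.≤-antisym (subst (ℕ._≤ m) 2+s≡L (ℕₚ.≰⇒> m≰1+s)) m≤L)

  r′ : ℕ
  r′ = L ℕ.∸ suc (suc (suc s))

  L≡ : L ≡ suc (suc s) ℕ.+ suc r′
  L≡ = sym (trans (ℕₚ.+-suc (suc (suc s)) r′) (ℕₚ.m+[n∸m]≡n 2+s<L))

  open Eventually c L-pos cL-pos (proj₂ sums≥) using (N₊)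
  open Eventually.InnerCoefficient c L-pos cL-pos (proj₂ sums≥) (suc s) r′ L≡ cs+1-pos using (eventually-increasing)

  plrr : Σ (List ℕ) λ b → IsPLRR b × DerivedFrom b c
  plrr = plrr-from-increment 2≤L n (ℕₚ.≤-trans (ℕₚ.m≤m+n L _) N₊≤n) increasing
    where
    n : ℕ
    n = proj₁ eventually-increasing
    N₊≤n : N₊ ℕ.≤ n
    N₊≤n = proj₁ (proj₂ eventually-increasing)
    increasing : ∀ j → j ℕ.< L → 0ℤ < increment n j
    increasing = proj₂ (proj₂ eventually-increasing)

corollary1p10 : (s : ℕ) (c : List ℕ) → IsZLRR s c →
    Σ (List ℕ) λ b → IsPLRR b × DerivedFrom b c
corollary1p10 zero    c zlrr = plrr-of-shallow c zlrr
corollary1p10 (suc s) c zlrr = Deep.plrr s c zlrr
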